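{- The following graph classes have the CKS property: split graphs, pseudo-split graphs, threshold graphs, and, for any fixed integer $d$, graphs of maximum degree at most $d$.
   Context: All graphs are finite, simple and undirected. A graph is split if its vertex set can be partitioned into a clique and an independent set. A graph is pseudo-split if its vertex set can be partitioned into three (possibly empty) sets $C,S,I$ such that $C$ is a clique, $I$ is an independent set, $S$ is either empty or induces a 5-cycle, every vertex of $C$ is adjacent to every vertex of $S$, and no vertex of $I$ is adjacent to any vertex of $S$. A graph is threshold if it contains none of $2K_2$ (two disjoint edges), $C_4$ (the 4-cycle), $P_4$ (the path on four vertices) as an induced subgraph. For a graph class $\mathcal{P}$ and graph $G$, $U\subseteq V(G)$ is a maximal $\mathcal{P}$ set if $G[U]\in\mathcal{P}$ and no proper superset has this property. A class $\mathcal{P}$ has the CKS property if there is a polynomial $p$ such that every graph $G$ on $n$ vertices having a maximal $\mathcal{P}$ set of size $n-1$ has at most $p(n)$ maximal $\mathcal{P}$ sets. -}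

module Defs where

open import Data.Nat using (ℕ; zero; suc; _+_; _*_; _^_; _≤_; _≡ᵇ_)
open import Data.Bool using (Bool; true; false; _∧_; _∨_)
open import Data.Fin using (Fin; toℕ)
open import Data.Fin.Subset using (Subset; _∈_; _∉_; _⊂_; _∩_; _∪_; ⊥; ∣_∣)
open import Data.Vec using (tabulate)
open import Data.List using (List; []; _∷_; length)
open import Data.List.Relation.Unary.All using (All)
open import Data.List.Relation.Unary.Unique.Propositional using (Unique)
open import Data.Product using (Σ; ∃; _×_; _,_)
open import Data.Sum using (_⊎_)
open import Relation.Binary.PropositionalEquality using (_≡_; _≢_)
open import Relation.Nullary using (¬_)
open import Function.Definitions using (Injective)

record Graph (n : ℕ) : Set where
  field
    adj    : Fin n → Fin n → Bool
    sym    : ∀ x y → adj x y ≡ adj y x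
    irrefl : ∀ x → adj x x ≡ false
open Graph public

N : ∀ {n} → Graph n → Fin n → Subset n
N G v = tabulate (adj G v)

-- A property of induced subgraphs: P G U means "G[U] ∈ 𝒫".
VProp : Set₁
VProp = ∀ {n} → Graph n → Subset n → Set

IsClique : ∀ {n} → Graph n → Subset n → Set
IsClique G C = ∀ x y → x ∈ C → y ∈ C → x ≢ y → adj G x y ≡ true

IsIndependent : ∀ {n} → Graph n → Subset n → Set
IsIndependent G I = ∀ x y → x ∈ I → y ∈ I → adj G x y ≡ false

mem : ℕ → ℕ → List (ℕ × ℕ) → Bool
mem a b [] = false
mem a b ((x , y) ∷ es) = ((a ≡ᵇ x) ∧ (b ≡ᵇ y)) ∨ ((a ≡ᵇ y) ∧ (b ≡ᵇ x)) ∨ mem a b es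

pattern' : ∀ {k} → List (ℕ × ℕ) → Fin k → Fin k → Bool
pattern' es i j = mem (toℕ i) (toℕ j) es

twoK2 : Fin 4 → Fin 4 → Bool
twoK2 = pattern' ((0 , 1) ∷ (2 , 3) ∷ [])

C4 : Fin 4 → Fin 4 → Bool
C4 = pattern' ((0 , 1) ∷ (1 , 2) ∷ (2 , 3) ∷ (3 , 0) ∷ [])

P4 : Fin 4 → Fin 4 → Bool
P4 = pattern' ((0 , 1) ∷ (1 , 2) ∷ (2 , 3) ∷ [])

C5 : Fin 5 → Fin 5 → Bool
C5 = pattern' ((0 , 1) ∷ (1 , 2) ∷ (2 , 3) ∷ (3 , 4) ∷ (4 , 0) ∷ [])

InducedEmbedding : ∀ {k n} → (Fin k → Fin k → Bool) → Graph n → (Fin k → Fin n) → Set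
InducedEmbedding H G f = Injective _≡_ _≡_ f × (∀ i j → adj G (f i) (f j) ≡ H i j)

ContainsInduced : ∀ {k n} → (Fin k → Fin k → Bool) → Graph n → Subset n → Set
ContainsInduced {k} H G U =
  Σ (Fin k → Fin _) λ f → InducedEmbedding H G f × (∀ i → f i ∈ U)

InducesC5 : ∀ {n} → Graph n → Subset n → Set
InducesC5 G S =
  Σ (Fin 5 → Fin _) λ f → InducedEmbedding C5 G f × (∀ v → v ∈ S → ∃ λ i → f i ≡ v)
                                                 × (∀ i → f i ∈ S)

Split : VProp
Split G U = Σ _ λ C → Σ _ λ I →
  (C ∪ I ≡ U) × (C ∩ I ≡ ⊥) × IsClique G C × IsIndependent G I

PseudoSplit : VProp
PseudoSplit G U = Σ _ λ C → Σ _ λ S → Σ _ λ I →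
  (C ∪ S ∪ I ≡ U) × (C ∩ S ≡ ⊥) × (C ∩ I ≡ ⊥) × (S ∩ I ≡ ⊥)
  × IsClique G C × IsIndependent G I
  × (S ≡ ⊥ ⊎ InducesC5 G S)
  × (∀ x y → x ∈ C → y ∈ S → adj G x y ≡ true)
  × (∀ x y → x ∈ I → y ∈ S → adj G x y ≡ false)

Threshold : VProp
Threshold G U =
  ¬ ContainsInduced twoK2 G U × ¬ ContainsInduced C4 G U × ¬ ContainsInduced P4 G U

MaxDegreeAtMost : ℕ → VProp
MaxDegreeAtMost d G U = ∀ v → v ∈ U → ∣ U ∩ N G v ∣ ≤ d

MaximalSet : VProp → VProp
MaximalSet P G U = P G U × (∀ W → U ⊂ W → ¬ P G W)

Poly : Set
Poly = List ℕ

eval : Poly → ℕ → ℕ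
eval [] x = 0
eval (c ∷ cs) x = c + x * eval cs x

AtMostMaximal : VProp → ∀ {n} → Graph n → ℕ → Set
AtMostMaximal P {n} G m =
  ∀ (L : List (Subset n)) → Unique L → All (MaximalSet P G) L → length L ≤ m

CKS : VProp → Set
CKS P = Σ Poly λ p → ∀ n (G : Graph n) →
  (Σ (Subset n) λ U → MaximalSet P G U × suc ∣ U ∣ ≡ n) →
  AtMostMaximal P G (eval p n)

-- Let U be a maximal 𝒫-set missing a single vertex v. A maximal 𝒫-set avoiding v is U itself. A 𝒫-set W
-- through v is contained in a 𝒫-set that can be rebuilt from U and a bounded number of vertices of W, each
-- named by one of n + 1 values: for split graphs the at most two vertices of each side of W outside the
-- corresponding side of U (v, and one vertex of the other side of U, since a clique meets an independent
-- set at most once); for pseudo-split graphs additionally the vertices of the two 5-cycles; for threshold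
-- graphs whether W ∩ N(v) is a clique and the extreme vertices of W ∩ N(v) and W ∖ N[v] in the vicinal
-- preorder of U; for maximum degree d the neighbours of v in W and their neighbours in W. By maximality
-- W is the rebuilt set, so there are at most 1 + c (n + 1) ^ k maximal 𝒫-sets.
module Submission where

open import Data.Bool using (Bool; true; false)
open import Data.Bool.Properties using (¬-not; not-¬) renaming (_≟_ to _≟ᵇ_)
open import Data.Empty using (⊥; ⊥-elim)
open import Data.Fin using (Fin; zero; suc)
open import Data.Fin using (_<_)
open import Data.Fin.Patterns using (0F; 1F; 2F; 3F)
open import Data.Fin.Properties using (injective⇒≤; any?; all?; ¬∀⟶∃¬; <-cmp) renaming (_≟_ to _≟ᶠ_)
open import Data.Fin.Subset using (Subset; _∈_; _∉_; _⊆_; _∩_; _∪_; ∣_∣; inside; outside) renaming (⊥ to ∅)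
open import Data.Fin.Subset.Properties
  using ( _∈?_; ⊆-antisym; ∩-zeroʳ; x∈p∩q⁺; x∈p∩q⁻; x∈p∪q⁺; x∈p∪q⁻; ∉⊥; Empty-unique; ∣p∣≡n⇒p≡⊤; ∈⊤
        ; p⊆q⇒∣p∣≤∣q∣)
open import Data.List
  using (List; []; _∷_; [_]; length; map; _++_; allFin; lookup; cartesianProductWith; cartesianProduct)
open import Data.List.Membership.Propositional using (find; lose) renaming (_∈_ to _∈ₗ_)
open import Data.List.Membership.Propositional.Properties
  using (∈-lookup; ∈-map⁺; ∈-map⁻; ∈-allFin; ∈-cartesianProductWith⁺; ∈-cartesianProduct⁺)
open import Data.List.Membership.Setoid.Properties using (index-injective)
open import Data.List.Properties using (length-map; length-++; length-tabulate)
open import Data.List.Relation.Unary.All as All using (All; []; _∷_)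
open import Data.List.Relation.Unary.All.Properties using (¬All⇒Any¬) renaming (map⁺ to All-map⁺)
open import Data.List.Relation.Unary.AllPairs using (_∷_)
open import Data.List.Relation.Unary.Any as Any using (here; there)
open import Data.List.Relation.Unary.Any.Properties using (¬Any[])
open import Data.List.Relation.Unary.Unique.Propositional using (Unique)
open import Data.Maybe using (Maybe; just; nothing; maybe′)
open import Data.Maybe.Properties using (≡-dec)
open import Data.Nat using (ℕ; zero; suc; _+_; _*_; _^_; _≤_; s≤s)
import Data.Nat.Properties as ℕ
open import Algebra.Properties.CommutativeSemigroup ℕ.+-commutativeSemigroup using (interchange)
open import Algebra.Properties.CommutativeSemigroup ℕ.*-commutativeSemigroup using (x∙yz≈y∙xz)
open import Data.Product using (Σ; ∃; _×_; _,_; proj₁; proj₂)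
open import Function using (_∘_)
open import Data.Sum using (_⊎_; inj₁; inj₂; swap)
open import Data.Unit using (⊤; tt)
open import Data.Vec using (tabulate; []; _∷_; here; there)
open import Data.Vec.Properties using (lookup∘tabulate; []=⇒lookup; lookup⇒[]=)
open import Relation.Binary.PropositionalEquality
  using (_≡_; _≢_; refl; sym; trans; cong; cong₂; subst; setoid; ≢-sym; module ≡-Reasoning)
open import Relation.Nullary using (¬_; Dec; yes; no; does)
open import Relation.Nullary.Decidable using (dec-true; decidable-stable; from-yes; _×-dec_; _⊎-dec_; ¬?; _→-dec_)
open import Relation.Binary.Definitions using (tri<; tri≈; tri>)
open import Relation.Unary using (Decidable)

open import Defs hiding (sym)

private
  variable
    A B C : Set
    n : ℕ

module _ (G : Graph n) where

  adj-sym : ∀ {x y b} → adj G x y ≡ b → adj G y x ≡ b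
  adj-sym {x} {y} e = trans (Graph.sym G y x) e

  adj⇒≢ : ∀ {x y} → adj G x y ≡ true → x ≢ y
  adj⇒≢ {x} e refl with () ← trans (sym e) (Graph.irrefl G x)

  separated⇒≢ : ∀ {c a b} → adj G c a ≡ true → adj G c b ≡ false → a ≢ b
  separated⇒≢ ca cb refl = not-¬ ca cb

∈-tabulate⁺ : ∀ {f : Fin n → Bool} {x} → f x ≡ true → x ∈ tabulate f
∈-tabulate⁺ {f = f} {x} fx = lookup⇒[]= x (tabulate f) (trans (lookup∘tabulate f x) fx)

∈-tabulate⁻ : ∀ {f : Fin n → Bool} {x} → x ∈ tabulate f → f x ≡ true
∈-tabulate⁻ {f = f} {x} x∈ = trans (sym (lookup∘tabulate f x)) ([]=⇒lookup x∈)

select : ∀ {Q : Fin n → Set} → Decidable Q → Subset n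
select Q? = tabulate (λ x → does (Q? x))

module _ {Q : Fin n → Set} (Q? : Decidable Q) where

  ∈-select⁺ : ∀ {x} → Q x → x ∈ select Q?
  ∈-select⁺ {x} q = ∈-tabulate⁺ (dec-true (Q? x) q)

  ∈-select⁻ : ∀ {x} → x ∈ select Q? → Q x
  ∈-select⁻ {x} x∈ = witness (Q? x) (∈-tabulate⁻ x∈)
    where
    witness : ∀ {P : Set} (P? : Dec P) → does P? ≡ true → P
    witness (yes p) _ = p

∩≡∅⇒disjoint : ∀ {p q : Subset n} → p ∩ q ≡ ∅ → ∀ {x} → x ∈ p → x ∉ q
∩≡∅⇒disjoint p∩q≡∅ x∈p x∈q = ∉⊥ (subst (_ ∈_) p∩q≡∅ (x∈p∩q⁺ (x∈p , x∈q)))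

disjoint⇒∩≡∅ : ∀ {p q : Subset n} → (∀ {x} → x ∈ p → x ∉ q) → p ∩ q ≡ ∅
disjoint⇒∩≡∅ {p = p} {q} disjoint =
  Empty-unique (λ (x , x∈p∩q) → let (x∈p , x∈q) = x∈p∩q⁻ p q x∈p∩q in disjoint x∈p x∈q)

∩≡∅-sym : ∀ {p q : Subset n} → p ∩ q ≡ ∅ → q ∩ p ≡ ∅
∩≡∅-sym p∩q≡∅ = disjoint⇒∩≡∅ (λ x∈q x∈p → ∩≡∅⇒disjoint p∩q≡∅ x∈p x∈q)

missingVertex : (U : Subset n) → suc ∣ U ∣ ≡ n → ∃ λ v → v ∉ U × (∀ x → x ≢ v → x ∈ U)
missingVertex {suc n} (outside ∷ U) |U|≡n = zero , (λ ()) , inU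
  where
  inU : ∀ x → x ≢ zero → x ∈ outside ∷ U
  inU zero x≢0 = ⊥-elim (x≢0 refl)
  inU (suc x) _ = there (subst (x ∈_) (sym (∣p∣≡n⇒p≡⊤ (ℕ.suc-injective |U|≡n))) ∈⊤)
missingVertex {suc n} (inside ∷ U) |U|≡n
  with v , v∉U , inU ← missingVertex U (ℕ.suc-injective |U|≡n) =
  suc v , (λ { (there v∈U) → v∉U v∈U }) , inU'
  where
  inU' : ∀ x → x ≢ suc v → x ∈ inside ∷ U
  inU' zero _ = here
  inU' (suc x) x≢v = there (inU x (λ { refl → x≢v refl }))

Unique⇒lookup-injective : ∀ {xs : List A} → Unique xs → ∀ {i j} → lookup xs i ≡ lookup xs j → i ≡ j
Unique⇒lookup-injective (_ ∷ _) {zero} {zero} _ = refl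
Unique⇒lookup-injective (x≢ ∷ _) {zero} {suc j} x≡ = ⊥-elim (All.lookup x≢ (∈-lookup j) x≡)
Unique⇒lookup-injective (x≢ ∷ _) {suc i} {zero} ≡x = ⊥-elim (All.lookup x≢ (∈-lookup i) (sym ≡x))
Unique⇒lookup-injective (_ ∷ unique) {suc i} {suc j} e = cong suc (Unique⇒lookup-injective unique e)

Unique⇒length≤ : ∀ {xs ys : List A} → Unique xs → All (_∈ₗ ys) xs → length xs ≤ length ys
Unique⇒length≤ {xs = xs} unique xs⊆ys = injective⇒≤ {f = position} position-injective
  where
  position : Fin (length xs) → Fin _
  position i = Any.index (All.lookup xs⊆ys (∈-lookup i))

  position-injective : ∀ {i j} → position i ≡ position j → i ≡ j
  position-injective e =
    Unique⇒lookup-injective unique (index-injective (setoid _) (All.lookup xs⊆ys (∈-lookup _)) _ e)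

module _ (P : VProp) (G : Graph n) where

  maximal-⊆⇒≡ : ∀ {W X} → MaximalSet P G W → W ⊆ X → P G X → W ≡ X
  maximal-⊆⇒≡ {W} {X} (_ , maximal) W⊆X PX = ⊆-antisym W⊆X X⊆W
    where
    X⊆W : X ⊆ W
    X⊆W {x} x∈X with x ∈? W
    ... | yes x∈W = x∈W
    ... | no x∉W = ⊥-elim (maximal X (W⊆X , x , x∈X , x∉W) PX)

  CoveredBy : List (Subset n) → Set
  CoveredBy Xs = ∀ W → P G W → ∃ λ X → X ∈ₗ Xs × W ⊆ X × P G X

  CoveredBy⇒AtMostMaximal : ∀ {Xs} → CoveredBy Xs → AtMostMaximal P G (length Xs)
  CoveredBy⇒AtMostMaximal {Xs} cover Ws unique maximal = Unique⇒length≤ unique (All.map listed maximal)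
    where
    listed : ∀ {W} → MaximalSet P G W → W ∈ₗ Xs
    listed {W} mW with X , X∈Xs , W⊆X , PX ← cover W (proj₁ mW)
      rewrite maximal-⊆⇒≡ mW W⊆X PX = X∈Xs

length-cartesianProductWith : ∀ (f : A → B → C) xs ys →
  length (cartesianProductWith f xs ys) ≡ length xs * length ys
length-cartesianProductWith f [] ys = refl
length-cartesianProductWith f (x ∷ xs) ys = begin
  length (map (f x) ys ++ cartesianProductWith f xs ys)             ≡⟨ length-++ (map (f x) ys) ⟩
  length (map (f x) ys) + length (cartesianProductWith f xs ys)     ≡⟨ cong₂ _+_ (length-map (f x) ys)
                                                                          (length-cartesianProductWith f xs ys) ⟩
  length ys + length xs * length ys                                 ∎
  where open ≡-Reasoning

listsOfLength : List A → ℕ → List (List A)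
listsOfLength xs zero = [ [] ]
listsOfLength xs (suc k) = cartesianProductWith _∷_ xs (listsOfLength xs k)

length-listsOfLength : ∀ (xs : List A) k → length (listsOfLength xs k) ≡ length xs ^ k
length-listsOfLength xs zero = refl
length-listsOfLength xs (suc k) =
  trans (length-cartesianProductWith _∷_ xs (listsOfLength xs k)) (cong (length xs *_) (length-listsOfLength xs k))

∈-listsOfLength⁺ : ∀ {xs ys : List A} {k} → length ys ≡ k → All (_∈ₗ xs) ys → ys ∈ₗ listsOfLength xs k
∈-listsOfLength⁺ {k = zero} refl [] = here refl
∈-listsOfLength⁺ {k = suc k} |ys|≡1+k (y∈xs ∷ ys⊆xs) =
  ∈-cartesianProductWith⁺ _∷_ y∈xs (∈-listsOfLength⁺ (ℕ.suc-injective |ys|≡1+k) ys⊆xs)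

allMaybeFin : ∀ n → List (Maybe (Fin n))
allMaybeFin n = nothing ∷ map just (allFin n)

length-allMaybeFin : ∀ n → length (allMaybeFin n) ≡ suc n
length-allMaybeFin n = cong suc (trans (length-map just (allFin n)) (length-tabulate _))

∈-allMaybeFin : ∀ (m : Maybe (Fin n)) → m ∈ₗ allMaybeFin n
∈-allMaybeFin nothing = here refl
∈-allMaybeFin (just x) = there (∈-map⁺ just (∈-allFin x))

-- All lists of k optional vertices; a list of length k denotes a set of at most k vertices.
Slots : ℕ → List (List (Maybe (Fin n)))
Slots {n} k = listsOfLength (allMaybeFin n) k

length-Slots : ∀ n k → length (Slots {n} k) ≡ suc n ^ k
length-Slots n k = trans (length-listsOfLength (allMaybeFin n) k) (cong (_^ k) (length-allMaybeFin n))

∈-Slots : ∀ {k} (ms : List (Maybe (Fin n))) → length ms ≡ k → ms ∈ₗ Slots k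
∈-Slots ms |ms|≡k = ∈-listsOfLength⁺ |ms|≡k (All.tabulate (λ {m} _ → ∈-allMaybeFin m))

length-cartesianProduct-^ : ∀ (xs : List A) (ys : List B) m j k →
  length xs ≡ m ^ j → length ys ≡ m ^ k → length (cartesianProduct xs ys) ≡ m ^ (j + k)
length-cartesianProduct-^ xs ys m j k |xs| |ys| = begin
  length (cartesianProduct xs ys)  ≡⟨ length-cartesianProductWith _,_ xs ys ⟩
  length xs * length ys            ≡⟨ cong₂ _*_ |xs| |ys| ⟩
  m ^ j * m ^ k                    ≡⟨ ℕ.^-distribˡ-+-* m j k ⟨
  m ^ (j + k)                      ∎
  where open ≡-Reasoning

elements : Subset n → List (Fin n)
elements [] = []
elements (inside ∷ p) = zero ∷ map suc (elements p)
elements (outside ∷ p) = map suc (elements p)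

length-elements : ∀ (p : Subset n) → length (elements p) ≡ ∣ p ∣
length-elements [] = refl
length-elements (inside ∷ p) = cong suc (trans (length-map suc (elements p)) (length-elements p))
length-elements (outside ∷ p) = trans (length-map suc (elements p)) (length-elements p)

∈-elements⁺ : ∀ (p : Subset n) {x} → x ∈ p → x ∈ₗ elements p
∈-elements⁺ (inside ∷ p) here = here refl
∈-elements⁺ (inside ∷ p) (there x∈p) = there (∈-map⁺ suc (∈-elements⁺ p x∈p))
∈-elements⁺ (outside ∷ p) (there x∈p) = ∈-map⁺ suc (∈-elements⁺ p x∈p)

∈-elements⁻ : ∀ (p : Subset n) {x} → x ∈ₗ elements p → x ∈ p
∈-elements⁻ (inside ∷ p) (here refl) = here
∈-elements⁻ (inside ∷ p) (there x∈) with y , y∈ , refl ← ∈-map⁻ suc x∈ = there (∈-elements⁻ p y∈)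
∈-elements⁻ (outside ∷ p) x∈ with y , y∈ , refl ← ∈-map⁻ suc x∈ = there (∈-elements⁻ p y∈)

padTo : ℕ → List A → List (Maybe A)
padTo zero xs = []
padTo (suc k) [] = nothing ∷ padTo k []
padTo (suc k) (x ∷ xs) = just x ∷ padTo k xs

length-padTo : ∀ k (xs : List A) → length (padTo k xs) ≡ k
length-padTo zero xs = refl
length-padTo (suc k) [] = cong suc (length-padTo k [])
length-padTo (suc k) (x ∷ xs) = cong suc (length-padTo k xs)

∈-padTo⁺ : ∀ {k} {xs : List A} {y} → length xs ≤ k → y ∈ₗ xs → just y ∈ₗ padTo k xs
∈-padTo⁺ {k = suc k} {x ∷ xs} _ (here refl) = here refl
∈-padTo⁺ {k = suc k} {x ∷ xs} (s≤s |xs|≤k) (there y∈xs) = there (∈-padTo⁺ |xs|≤k y∈xs)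

∈-padTo⁻ : ∀ k (xs : List A) {y} → just y ∈ₗ padTo k xs → y ∈ₗ xs
∈-padTo⁻ (suc k) [] (there y∈) = ∈-padTo⁻ k [] y∈
∈-padTo⁻ (suc k) (x ∷ xs) (here refl) = here refl
∈-padTo⁻ (suc k) (x ∷ xs) (there y∈) = there (∈-padTo⁻ k xs y∈)

slotsOf : ℕ → Subset n → List (Maybe (Fin n))
slotsOf k X = padTo k (elements X)

∈-slotsOf⁺ : ∀ {k} {X : Subset n} {x} → ∣ X ∣ ≤ k → x ∈ X → just x ∈ₗ slotsOf k X
∈-slotsOf⁺ {X = X} |X|≤k x∈X =
  ∈-padTo⁺ (subst (_≤ _) (sym (length-elements X)) |X|≤k) (∈-elements⁺ X x∈X)

∈-slotsOf⁻ : ∀ k (X : Subset n) {x} → just x ∈ₗ slotsOf k X → x ∈ X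
∈-slotsOf⁻ k X x∈ = ∈-elements⁻ X (∈-padTo⁻ k (elements X) x∈)

slotsOf∈Slots : ∀ k (X : Subset n) → slotsOf k X ∈ₗ Slots k
slotsOf∈Slots k X = ∈-Slots (slotsOf k X) (length-padTo k (elements X))

_∈ₛ?_ : ∀ (x : Fin n) ms → Dec (just x ∈ₗ ms)
x ∈ₛ? ms = Any.any? (≡-dec _≟ᶠ_ (just x)) ms

module _ (G : Graph n) where

  SlotAdj : Bool → Fin n → Maybe (Fin n) → Set
  SlotAdj b x nothing = ⊤
  SlotAdj b x (just y) = adj G y x ≡ b

  slotAdj? : ∀ b x m → Dec (SlotAdj b x m)
  slotAdj? b x nothing = yes tt
  slotAdj? b x (just y) = adj G y x ≟ᵇ b

  AdjToAll : Bool → List (Maybe (Fin n)) → Fin n → Set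
  AdjToAll b ms x = All (SlotAdj b x) ms

  adjToAll? : ∀ b ms x → Dec (AdjToAll b ms x)
  adjToAll? b ms x = All.all? (slotAdj? b x) ms

  AdjToAll-lookup : ∀ {b ms x y} → AdjToAll b ms x → just y ∈ₗ ms → adj G y x ≡ b
  AdjToAll-lookup all = All.lookup all

  AdjToAll-tabulate : ∀ {b} ms {x} → (∀ {y} → just y ∈ₗ ms → adj G y x ≡ b) → AdjToAll b ms x
  AdjToAll-tabulate ms adj≡b = All.tabulate slotAdj
    where
    slotAdj : ∀ {m} → m ∈ₗ ms → SlotAdj _ _ m
    slotAdj {nothing} _ = tt
    slotAdj {just y} y∈ms = adj≡b y∈ms

module Least {U : Subset n} (_R_ : Fin n → Fin n → Set) (R-refl : ∀ x → x R x)
  (R-trans : ∀ {x y z} → x ∈ U → z ∈ U → x R y → y R z → x R z)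
  (R-total : ∀ {x y} → x ∈ U → y ∈ U → x R y ⊎ y R x) where

  least-∷ : ∀ x xs → All (_∈ U) (x ∷ xs) → ∃ λ m → m ∈ₗ x ∷ xs × All (m R_) (x ∷ xs)
  least-∷ x [] _ = x , here refl , R-refl x ∷ []
  least-∷ x (y ∷ ys) (x∈U ∷ ys⊆U) with m , m∈ , mR ← least-∷ y ys ys⊆U
    with R-total x∈U (All.lookup ys⊆U m∈)
  ... | inj₁ xRm =
    x , here refl , R-refl x ∷ All.tabulate (λ z∈ → R-trans x∈U (All.lookup ys⊆U z∈) xRm (All.lookup mR z∈))
  ... | inj₂ mRx = m , there m∈ , mRx ∷ mR

  LeastOf : Subset n → Set
  LeastOf A = (∃ λ m → m ∈ A × ∀ {y} → y ∈ A → m R y) ⊎ (∀ {y} → y ∉ A)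

  least : (A : Subset n) → (∀ {y} → y ∈ A → y ∈ U) → LeastOf A
  least A A⊆U with elements A | ∈-elements⁺ A | ∈-elements⁻ A
  ... | [] | complete | _ = inj₂ (λ y∈A → ¬Any[] (complete y∈A))
  ... | x ∷ xs | complete | sound with m , m∈ , mR ← least-∷ x xs (All.tabulate (λ y∈ → A⊆U (sound y∈))) =
    inj₁ (m , sound m∈ , λ y∈A → All.lookup mR (complete y∈A))

  leastVertex : ∀ {A} → LeastOf A → Maybe (Fin n)
  leastVertex (inj₁ (m , _)) = just m
  leastVertex (inj₂ _) = nothing

_+ₚ_ : Poly → Poly → Poly
[] +ₚ q = q
(a ∷ p) +ₚ [] = a ∷ p
(a ∷ p) +ₚ (b ∷ q) = (a + b) ∷ (p +ₚ q)

eval-+ₚ : ∀ p q x → eval (p +ₚ q) x ≡ eval p x + eval q x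
eval-+ₚ [] q x = refl
eval-+ₚ (a ∷ p) [] x = sym (ℕ.+-identityʳ _)
eval-+ₚ (a ∷ p) (b ∷ q) x = begin
  a + b + x * eval (p +ₚ q) x                ≡⟨ cong (λ y → a + b + x * y) (eval-+ₚ p q x) ⟩
  a + b + x * (eval p x + eval q x)          ≡⟨ cong (a + b +_) (ℕ.*-distribˡ-+ x (eval p x) (eval q x)) ⟩
  a + b + (x * eval p x + x * eval q x)      ≡⟨ interchange a b (x * eval p x) (x * eval q x) ⟩
  a + x * eval p x + (b + x * eval q x)      ∎
  where open ≡-Reasoning

scaledPower : ℕ → ℕ → Poly
scaledPower M zero = [ M ]
scaledPower M (suc K) = scaledPower M K +ₚ (0 ∷ scaledPower M K)

eval-scaledPower : ∀ M K x → eval (scaledPower M K) x ≡ M * suc x ^ K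
eval-scaledPower M zero x = begin
  M + x * 0   ≡⟨ cong (M +_) (ℕ.*-zeroʳ x) ⟩
  M + 0       ≡⟨ ℕ.+-identityʳ M ⟩
  M           ≡⟨ ℕ.*-identityʳ M ⟨
  M * 1       ∎
  where open ≡-Reasoning
eval-scaledPower M (suc K) x = begin
  eval (scaledPower M K +ₚ (0 ∷ scaledPower M K)) x   ≡⟨ eval-+ₚ (scaledPower M K) (0 ∷ scaledPower M K) x ⟩
  suc x * eval (scaledPower M K) x                     ≡⟨ cong (suc x *_) (eval-scaledPower M K x) ⟩
  suc x * (M * suc x ^ K)                              ≡⟨ x∙yz≈y∙xz (suc x) M (suc x ^ K) ⟩
  M * suc x ^ suc K                                    ∎
  where open ≡-Reasoning

incrₚ : Poly → Poly
incrₚ [] = [ 1 ]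
incrₚ (c ∷ p) = suc c ∷ p

eval-incrₚ : ∀ p x → eval (incrₚ p) x ≡ suc (eval p x)
eval-incrₚ [] x = cong suc (ℕ.*-zeroʳ x)
eval-incrₚ (c ∷ p) x = refl

record Catalogue (P : VProp) (G : Graph n) (v : Fin n) (size : ℕ) : Set₁ where
  field
    Code         : Set
    codes        : List Code
    length-codes : length codes ≡ size
    decode       : Code → Subset n
    covers       : ∀ W → P G W → v ∈ W → ∃ λ c → c ∈ₗ codes × W ⊆ decode c × P G (decode c)

CKS-fromCatalogues : (P : VProp) (M K : ℕ) →
  (∀ {n} (G : Graph n) {U v} → P G U → (∀ x → x ≢ v → x ∈ U) → Catalogue P G v (M * suc n ^ K)) →
  CKS P
CKS-fromCatalogues P M K catalogue = incrₚ (scaledPower M K) , bound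
  where
  bound : ∀ n (G : Graph n) → (Σ (Subset n) λ U → MaximalSet P G U × suc ∣ U ∣ ≡ n) →
          AtMostMaximal P G (eval (incrₚ (scaledPower M K)) n)
  bound n G (U , (PU , _) , 1+|U|≡n) = subst (AtMostMaximal P G) length≡ (CoveredBy⇒AtMostMaximal P G covered)
    where
    v : Fin n
    v = proj₁ (missingVertex U 1+|U|≡n)

    inU : ∀ x → x ≢ v → x ∈ U
    inU = proj₂ (proj₂ (missingVertex U 1+|U|≡n))

    open Catalogue (catalogue G PU inU)

    covered : CoveredBy P G (U ∷ map decode codes)
    covered W PW with v ∈? W
    ... | yes v∈W with c , c∈codes , W⊆ , P[c] ← covers W PW v∈W =
      decode c , there (∈-map⁺ decode c∈codes) , W⊆ , P[c]
    ... | no v∉W = U , here refl , (λ {x} x∈W → inU x (λ { refl → v∉W x∈W })) , PU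

    length≡ : length (U ∷ map decode codes) ≡ eval (incrₚ (scaledPower M K)) n
    length≡ = begin
      suc (length (map decode codes))     ≡⟨ cong suc (trans (length-map decode codes) length-codes) ⟩
      suc (M * suc n ^ K)                 ≡⟨ cong suc (eval-scaledPower M K n) ⟨
      suc (eval (scaledPower M K) n)      ≡⟨ eval-incrₚ (scaledPower M K) n ⟨
      eval (incrₚ (scaledPower M K)) n    ∎
      where open ≡-Reasoning

-- Graphs of bounded degree

-- The code of W ∋ v lists the neighbours of v in W and, for each of them, its neighbours in W. The decoded
-- set also contains every vertex adjacent to neither v nor a listed neighbour of v: the neighbours of such a
-- vertex lie in U, and it does not count towards the degree of v or of a listed vertex.
module MaxDegreeCatalogue (d : ℕ) (G : Graph n) {U : Subset n} {v : Fin n}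
                          (degU : MaxDegreeAtMost d G U) (inU : ∀ x → x ≢ v → x ∈ U) where

  Code : Set
  Code = List (Maybe (Fin n)) × List (List (Maybe (Fin n)))

  codes : List Code
  codes = cartesianProduct (Slots d) (listsOfLength (Slots d) d)

  length-codes : length codes ≡ 1 * suc n ^ (d + d * d)
  length-codes = trans (length-cartesianProduct-^ (Slots {n} d) (listsOfLength (Slots d) d) (suc n) d (d * d)
                                                 (length-Slots n d) length-rows)
                       (sym (ℕ.*-identityˡ _))
    where
    length-rows : length (listsOfLength (Slots {n} d) d) ≡ suc n ^ (d * d)
    length-rows = trans (length-listsOfLength (Slots d) d)
                        (trans (cong (_^ d) (length-Slots n d)) (ℕ.^-*-assoc (suc n) d d))

  Remote : List (Maybe (Fin n)) → Fin n → Set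
  Remote ss x = x ≢ v × adj G v x ≡ false × AdjToAll G false ss x

  Member : Code → Fin n → Set
  Member (ss , ts) x = x ≡ v ⊎ just x ∈ₗ ss ⊎ Any.Any (just x ∈ₗ_) ts ⊎ Remote ss x

  member? : ∀ c x → Dec (Member c x)
  member? (ss , ts) x = x ≟ᶠ v ⊎-dec x ∈ₛ? ss ⊎-dec Any.any? (x ∈ₛ?_) ts
                        ⊎-dec (¬? (x ≟ᶠ v) ×-dec adj G v x ≟ᵇ false ×-dec adjToAll? G false ss x)

  decode : Code → Subset n
  decode c = select (member? c)

  degree-≤ : ∀ {X Y x} → (∀ {y} → y ∈ X → adj G x y ≡ true → y ∈ Y) →
             ∣ Y ∩ N G x ∣ ≤ d → ∣ X ∩ N G x ∣ ≤ d
  degree-≤ {X} {Y} {x} X∩N⊆Y deg = ℕ.≤-trans (p⊆q⇒∣p∣≤∣q∣ X∩N⊆Y∩N) deg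
    where
    X∩N⊆Y∩N : X ∩ N G x ⊆ Y ∩ N G x
    X∩N⊆Y∩N y∈ = let (y∈X , y∈N) = x∈p∩q⁻ X (N G x) y∈
                 in x∈p∩q⁺ (X∩N⊆Y y∈X (∈-tabulate⁻ y∈N) , y∈N)

  module _ (W : Subset n) (degW : MaxDegreeAtMost d G W) (v∈W : v ∈ W) where

    neighbourSlots : Maybe (Fin n) → List (Maybe (Fin n))
    neighbourSlots m = slotsOf d (W ∩ maybe′ (N G) ∅ m)

    ss : List (Maybe (Fin n))
    ss = slotsOf d (W ∩ N G v)

    code : Code
    code = ss , map neighbourSlots ss

    code∈codes : code ∈ₗ codes
    code∈codes = ∈-cartesianProduct⁺ (slotsOf∈Slots d (W ∩ N G v))
      (∈-listsOfLength⁺ (trans (length-map neighbourSlots ss) (length-padTo d _))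
                        (All-map⁺ (All.tabulate (λ {m} _ → slotsOf∈Slots d (W ∩ maybe′ (N G) ∅ m)))))

    listed⁺ : ∀ {x} → x ∈ W → adj G v x ≡ true → just x ∈ₗ ss
    listed⁺ x∈W vx = ∈-slotsOf⁺ (degW v v∈W) (x∈p∩q⁺ (x∈W , ∈-tabulate⁺ vx))

    listed⁻ : ∀ {x} → just x ∈ₗ ss → x ∈ W × adj G v x ≡ true
    listed⁻ x∈ss = let (x∈W , x∈N) = x∈p∩q⁻ W _ (∈-slotsOf⁻ d _ x∈ss) in x∈W , ∈-tabulate⁻ x∈N

    member⇒∈W⊎remote : ∀ {x} → Member code x → x ∈ W ⊎ Remote ss x
    member⇒∈W⊎remote (inj₁ refl) = inj₁ v∈W
    member⇒∈W⊎remote (inj₂ (inj₁ x∈ss)) = inj₁ (proj₁ (listed⁻ x∈ss))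
    member⇒∈W⊎remote (inj₂ (inj₂ (inj₁ x∈row)))
      with t , t∈rows , x∈t ← find x∈row
      with m , _ , refl ← ∈-map⁻ neighbourSlots t∈rows =
      inj₁ (proj₁ (x∈p∩q⁻ W _ (∈-slotsOf⁻ d _ x∈t)))
    member⇒∈W⊎remote (inj₂ (inj₂ (inj₂ remote))) = inj₂ remote

    W⊆decode : W ⊆ decode code
    W⊆decode {x} x∈W = ∈-select⁺ (member? code) (membership (x ≟ᶠ v))
      where
      rowMember : ∀ {m} → m ∈ₗ ss → ¬ SlotAdj G false x m → Any.Any (just x ∈ₗ_) (map neighbourSlots ss)
      rowMember {just s} s∈ss ¬sx = lose (∈-map⁺ neighbourSlots s∈ss)
        (∈-slotsOf⁺ (degW s (proj₁ (listed⁻ s∈ss))) (x∈p∩q⁺ (x∈W , ∈-tabulate⁺ (¬-not ¬sx))))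
      rowMember {nothing} _ ¬tt = ⊥-elim (¬tt tt)

      membership : Dec (x ≡ v) → Member code x
      membership (yes x≡v) = inj₁ x≡v
      membership (no x≢v) with adj G v x ≟ᵇ true | adjToAll? G false ss x
      ... | yes vx | _ = inj₂ (inj₁ (listed⁺ x∈W vx))
      ... | no ¬vx | yes remote = inj₂ (inj₂ (inj₂ (x≢v , ¬-not ¬vx , remote)))
      ... | no _   | no ¬remote with m , m∈ss , ¬mx ← find (¬All⇒Any¬ (slotAdj? G false x) ss ¬remote) =
        inj₂ (inj₂ (inj₁ (rowMember m∈ss ¬mx)))

    decode-maxDegree : MaxDegreeAtMost d G (decode code)
    decode-maxDegree x x∈ with x ≟ᶠ v | adj G v x ≟ᵇ true
    ... | yes refl | _ = degree-≤ N[v]⊆W (degW v v∈W)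
      where
      N[v]⊆W : ∀ {y} → y ∈ decode code → adj G v y ≡ true → y ∈ W
      N[v]⊆W y∈ vy with member⇒∈W⊎remote (∈-select⁻ (member? code) y∈)
      ... | inj₁ y∈W = y∈W
      ... | inj₂ (_ , vy≡false , _) = ⊥-elim (not-¬ vy vy≡false)
    ... | no x≢v | yes vx = degree-≤ N[x]⊆W (degW x x∈W)
      where
      x∈W : x ∈ W
      x∈W with member⇒∈W⊎remote (∈-select⁻ (member? code) x∈)
      ... | inj₁ x∈W = x∈W
      ... | inj₂ (_ , vx≡false , _) = ⊥-elim (not-¬ vx vx≡false)
      N[x]⊆W : ∀ {y} → y ∈ decode code → adj G x y ≡ true → y ∈ W
      N[x]⊆W y∈ xy with member⇒∈W⊎remote (∈-select⁻ (member? code) y∈)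
      ... | inj₁ y∈W = y∈W
      ... | inj₂ (_ , _ , missesSs) = ⊥-elim (not-¬ xy (AdjToAll-lookup G missesSs (listed⁺ x∈W vx)))
    ... | no x≢v | no ¬vx = degree-≤ N[x]⊆U (degU x (inU x x≢v))
      where
      N[x]⊆U : ∀ {y} → y ∈ decode code → adj G x y ≡ true → y ∈ U
      N[x]⊆U _ xy = inU _ λ { refl → ¬vx (adj-sym G xy) }

  catalogue : Catalogue (MaxDegreeAtMost d) G v (1 * suc n ^ (d + d * d))
  catalogue = record
    { codes = codes ; length-codes = length-codes ; decode = decode
    ; covers = λ W degW v∈W → code W degW v∈W , code∈codes W degW v∈W , W⊆decode W degW v∈W
                               , decode-maxDegree W degW v∈W }

CKS-maxDegree : ∀ d → CKS (MaxDegreeAtMost d)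
CKS-maxDegree d = CKS-fromCatalogues (MaxDegreeAtMost d) 1 (d + d * d)
  (λ G degU inU → MaxDegreeCatalogue.catalogue d G degU inU)

-- Split and pseudo-split graphs

Homogeneous : Graph n → Bool → Subset n → Set
Homogeneous G b X = ∀ x y → x ∈ X → y ∈ X → x ≢ y → adj G x y ≡ b

independent⇒homogeneous : ∀ (G : Graph n) {X} → IsIndependent G X → Homogeneous G false X
independent⇒homogeneous G indep x y x∈X y∈X _ = indep x y x∈X y∈X

homogeneous⇒independent : ∀ (G : Graph n) {X} → Homogeneous G false X → IsIndependent G X
homogeneous⇒independent G hom x y x∈X y∈X with x ≟ᶠ y
... | yes refl = Graph.irrefl G x
... | no x≢y = hom x y x∈X y∈X x≢y

-- The side of a decoded (pseudo-)split partition that is a clique (b = true) or an independent set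
-- (b = false): the listed vertices Os, and the vertices of the corresponding side Z of U that have adjacency
-- b to the listed vertices of this side and of the 5-cycle (Ss) and are not listed elsewhere.
module _ (G : Graph n) (Ss : List (Maybe (Fin n))) (b : Bool) (Z : Subset n) (Os Ts : List (Maybe (Fin n))) where

  PartMember : Fin n → Set
  PartMember x = just x ∈ₗ Os ⊎ (x ∈ Z × AdjToAll G b Ss x × AdjToAll G b Os x × ¬ just x ∈ₗ Ts × ¬ just x ∈ₗ Ss)

  partMember? : Decidable PartMember
  partMember? x = x ∈ₛ? Os ⊎-dec (x ∈? Z ×-dec adjToAll? G b Ss x ×-dec adjToAll? G b Os x
                                   ×-dec ¬? (x ∈ₛ? Ts) ×-dec ¬? (x ∈ₛ? Ss))

  part : Subset n
  part = select partMember?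

listed : List (Maybe (Fin n)) → Subset n
listed ms = select (_∈ₛ? ms)

module PartProperties (G : Graph n) {Ss : List (Maybe (Fin n))} {S : Subset n}
  (Ss⊆S : ∀ {y} → just y ∈ₗ Ss → y ∈ S)
  (b : Bool) {Z X Y : Subset n} {Os Ts : List (Maybe (Fin n))}
  (Z-hom : Homogeneous G b Z) (X-hom : Homogeneous G b X)
  (Os⊆X : ∀ {y} → just y ∈ₗ Os → y ∈ X) (Ts⊆Y : ∀ {y} → just y ∈ₗ Ts → y ∈ Y)
  (X∩Y≡∅ : X ∩ Y ≡ ∅) (X∩S≡∅ : X ∩ S ≡ ∅) (X-S : ∀ x y → x ∈ X → y ∈ S → adj G x y ≡ b) where

  private
    member : ∀ {x} → x ∈ part G Ss b Z Os Ts → PartMember G Ss b Z Os Ts x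
    member = ∈-select⁻ (partMember? G Ss b Z Os Ts)

  part-homogeneous : Homogeneous G b (part G Ss b Z Os Ts)
  part-homogeneous x y x∈ y∈ x≢y with member x∈ | member y∈
  ... | inj₁ x∈Os | inj₁ y∈Os = X-hom x y (Os⊆X x∈Os) (Os⊆X y∈Os) x≢y
  ... | inj₁ x∈Os | inj₂ (_ , _ , y~Os , _) = AdjToAll-lookup G y~Os x∈Os
  ... | inj₂ (_ , _ , x~Os , _) | inj₁ y∈Os = adj-sym G (AdjToAll-lookup G x~Os y∈Os)
  ... | inj₂ (x∈Z , _) | inj₂ (y∈Z , _) = Z-hom x y x∈Z y∈Z x≢y

  X⊆part : (∀ {x} → x ∈ X → x ∉ Z → just x ∈ₗ Os) → X ⊆ part G Ss b Z Os Ts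
  X⊆part strays {x} x∈X with x ∈ₛ? Os | x ∈? Z
  ... | yes x∈Os | _ = ∈-select⁺ (partMember? G Ss b Z Os Ts) (inj₁ x∈Os)
  ... | no x∉Os | no x∉Z = ⊥-elim (x∉Os (strays x∈X x∉Z))
  ... | no x∉Os | yes x∈Z = ∈-select⁺ (partMember? G Ss b Z Os Ts) (inj₂
    ( x∈Z
    , AdjToAll-tabulate G Ss (λ y∈Ss → adj-sym G (X-S x _ x∈X (Ss⊆S y∈Ss)))
    , AdjToAll-tabulate G Os (λ y∈Os → X-hom _ x (Os⊆X y∈Os) x∈X λ { refl → x∉Os y∈Os })
    , (λ x∈Ts → ∩≡∅⇒disjoint X∩Y≡∅ x∈X (Ts⊆Y x∈Ts))
    , (λ x∈Ss → ∩≡∅⇒disjoint X∩S≡∅ x∈X (Ss⊆S x∈Ss))))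

  part-Ss : ∀ x y → x ∈ part G Ss b Z Os Ts → just y ∈ₗ Ss → adj G x y ≡ b
  part-Ss x y x∈ y∈Ss with member x∈
  ... | inj₁ x∈Os = X-S x y (Os⊆X x∈Os) (Ss⊆S y∈Ss)
  ... | inj₂ (_ , x~Ss , _) = adj-sym G (AdjToAll-lookup G x~Ss y∈Ss)

  part-∉Ss : ∀ {x} → x ∈ part G Ss b Z Os Ts → ¬ just x ∈ₗ Ss
  part-∉Ss x∈ with member x∈
  ... | inj₁ x∈Os = λ x∈Ss → ∩≡∅⇒disjoint X∩S≡∅ (Os⊆X x∈Os) (Ss⊆S x∈Ss)
  ... | inj₂ (_ , _ , _ , _ , x∉Ss) = x∉Ss

parts-disjoint : ∀ (G : Graph n) Ss {C₀ I₀ C I Ks Js} → C₀ ∩ I₀ ≡ ∅ → C ∩ I ≡ ∅ →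
  (∀ {y} → just y ∈ₗ Ks → y ∈ C) → (∀ {y} → just y ∈ₗ Js → y ∈ I) →
  part G Ss true C₀ Ks Js ∩ part G Ss false I₀ Js Ks ≡ ∅
parts-disjoint G Ss {C₀} {I₀} {Ks = Ks} {Js} C₀∩I₀≡∅ C∩I≡∅ Ks⊆C Js⊆I = disjoint⇒∩≡∅ disjoint
  where
  disjoint : ∀ {x} → x ∈ part G Ss true C₀ Ks Js → x ∉ part G Ss false I₀ Js Ks
  disjoint x∈C' x∈I'
    with ∈-select⁻ (partMember? G Ss true C₀ Ks Js) x∈C' | ∈-select⁻ (partMember? G Ss false I₀ Js Ks) x∈I'
  ... | inj₁ x∈Ks | inj₁ x∈Js = ∩≡∅⇒disjoint C∩I≡∅ (Ks⊆C x∈Ks) (Js⊆I x∈Js)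
  ... | inj₁ x∈Ks | inj₂ (_ , _ , _ , x∉Ks , _) = x∉Ks x∈Ks
  ... | inj₂ (_ , _ , _ , x∉Js , _) | inj₁ x∈Js = x∉Js x∈Js
  ... | inj₂ (x∈C₀ , _) | inj₂ (x∈I₀ , _) = ∩≡∅⇒disjoint C₀∩I₀≡∅ x∈C₀ x∈I₀

-- A side X of W leaves its home side Z of U only through v, through at most one vertex of the opposite side Y
-- of U, and through the vertices listed in `others`; `strays` lists them all in a bounded number of slots.
module StraySlots {X Y Z : Subset n} (v : Fin n) (others : List (Maybe (Fin n)))
  (atMostOne : ∀ {a b} → a ∈ X → a ∈ Y → b ∈ X → b ∈ Y → a ≡ b)
  (others⊆X : ∀ {y} → just y ∈ₗ others → y ∈ X)
  (X∖Z⊆ : ∀ {x} → x ∈ X → x ∉ Z → x ≡ v ⊎ x ∈ Y ⊎ just x ∈ₗ others) where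

  vSlot : Dec (v ∈ X) → Maybe (Fin n)
  vSlot (yes _) = just v
  vSlot (no _) = nothing

  meetSlot : Dec (∃ λ x → x ∈ X × x ∈ Y) → Maybe (Fin n)
  meetSlot (yes (x , _)) = just x
  meetSlot (no _) = nothing

  meet? : Dec (∃ λ x → x ∈ X × x ∈ Y)
  meet? = any? (λ x → x ∈? X ×-dec x ∈? Y)

  strays : List (Maybe (Fin n))
  strays = vSlot (v ∈? X) ∷ meetSlot meet? ∷ others

  strays⊆X : ∀ {y} → just y ∈ₗ strays → y ∈ X
  strays⊆X (here y≡) with v ∈? X
  strays⊆X (here refl) | yes v∈X = v∈X
  strays⊆X (there (here y≡)) with meet?
  strays⊆X (there (here refl)) | yes (_ , x∈X , _) = x∈X
  strays⊆X (there (there y∈others)) = others⊆X y∈others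

  X∖Z⊆strays : ∀ {x} → x ∈ X → x ∉ Z → just x ∈ₗ strays
  X∖Z⊆strays {x} x∈X x∉Z with X∖Z⊆ x∈X x∉Z
  ... | inj₁ refl with v ∈? X
  ...   | yes _ = here refl
  ...   | no v∉X = ⊥-elim (v∉X x∈X)
  X∖Z⊆strays {x} x∈X x∉Z | inj₂ (inj₁ x∈Y) with meet?
  ...   | yes (a , a∈X , a∈Y) = there (here (cong just (atMostOne x∈X x∈Y a∈X a∈Y)))
  ...   | no ¬meet = ⊥-elim (¬meet (x , x∈X , x∈Y))
  X∖Z⊆strays x∈X x∉Z | inj₂ (inj₂ x∈others) = there (there x∈others)

filterSlot : Subset n → Fin n → Maybe (Fin n)
filterSlot X y with y ∈? X
... | yes _ = just y
... | no _ = nothing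

filterSlot-∈ : ∀ X {x y : Fin n} → just x ≡ filterSlot X y → x ∈ X × x ≡ y
filterSlot-∈ X {y = y} x≡ with y ∈? X
filterSlot-∈ X refl | yes y∈X = y∈X , refl

filterSlot-≡ : ∀ {X} {y : Fin n} → y ∈ X → filterSlot X y ≡ just y
filterSlot-≡ {X = X} {y} y∈X with y ∈? X
... | yes _ = refl
... | no y∉X = ⊥-elim (y∉X y∈X)

module _ (G : Graph n) {S : Subset n} where

  cycleSlots : S ≡ ∅ ⊎ InducesC5 G S → Subset n → List (Maybe (Fin n))
  cycleSlots (inj₁ _) X = map (λ _ → nothing) (allFin 5)
  cycleSlots (inj₂ (f , _)) X = map (filterSlot X ∘ f) (allFin 5)

  length-cycleSlots : ∀ s X → length (cycleSlots s X) ≡ 5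
  length-cycleSlots (inj₁ _) X = refl
  length-cycleSlots (inj₂ _) X = refl

  cycleSlots⊆ : ∀ s X {y} → just y ∈ₗ cycleSlots s X → y ∈ S × y ∈ X
  cycleSlots⊆ (inj₁ _) X y∈ with _ , _ , () ← ∈-map⁻ (λ (_ : Fin 5) → nothing {A = Fin n}) {xs = allFin 5} y∈
  cycleSlots⊆ (inj₂ (f , _ , _ , f∈S)) X y∈ with i , _ , y≡ ← ∈-map⁻ (filterSlot X ∘ f) y∈
    with y∈X , refl ← filterSlot-∈ X y≡ = f∈S i , y∈X

  ⊆cycleSlots : ∀ s X {y} → y ∈ S → y ∈ X → just y ∈ₗ cycleSlots s X
  ⊆cycleSlots (inj₁ refl) X y∈∅ _ = ⊥-elim (∉⊥ y∈∅)
  ⊆cycleSlots (inj₂ (f , _ , onto , _)) X y∈S y∈X with i , refl ← onto _ y∈S =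
    subst (_∈ₗ _) (filterSlot-≡ y∈X) (∈-map⁺ (filterSlot X ∘ f) (∈-allFin i))

clique∩independent-atMostOne : ∀ (G : Graph n) {X Y} → IsClique G X → IsIndependent G Y →
  ∀ {a b} → a ∈ X → a ∈ Y → b ∈ X → b ∈ Y → a ≡ b
clique∩independent-atMostOne G clique indep {a} {b} a∈X a∈Y b∈X b∈Y with a ≟ᶠ b
... | yes a≡b = a≡b
... | no a≢b = ⊥-elim (not-¬ (clique a b a∈X b∈X a≢b) (indep a b a∈Y b∈Y))

module SplitCatalogue (G : Graph n) {v : Fin n} {C₀ I₀ : Subset n}
  (C₀∩I₀≡∅ : C₀ ∩ I₀ ≡ ∅) (C₀-clique : IsClique G C₀) (I₀-indep : IsIndependent G I₀)
  (inU : ∀ x → x ≢ v → x ∈ C₀ ∪ I₀) where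

  Code : Set
  Code = List (Maybe (Fin n)) × List (Maybe (Fin n))

  codes : List Code
  codes = cartesianProduct (Slots 2) (Slots 2)

  length-codes : length codes ≡ 1 * suc n ^ 4
  length-codes = trans (length-cartesianProduct-^ (Slots {n} 2) (Slots {n} 2) (suc n) 2 2
                                                 (length-Slots n 2) (length-Slots n 2))
                       (sym (ℕ.*-identityˡ _))

  decode : Code → Subset n
  decode (Ks , Js) = part G [] true C₀ Ks Js ∪ part G [] false I₀ Js Ks

  module Cover {C I} (C∩I≡∅ : C ∩ I ≡ ∅) (C-clique : IsClique G C) (I-indep : IsIndependent G I) where

    C∖C₀⊆ : ∀ {x} → x ∈ C → x ∉ C₀ → x ≡ v ⊎ x ∈ I₀ ⊎ just x ∈ₗ []
    C∖C₀⊆ {x} _ x∉C₀ with x ≟ᶠ v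
    ... | yes x≡v = inj₁ x≡v
    ... | no x≢v with x∈p∪q⁻ C₀ I₀ (inU x x≢v)
    ...   | inj₁ x∈C₀ = ⊥-elim (x∉C₀ x∈C₀)
    ...   | inj₂ x∈I₀ = inj₂ (inj₁ x∈I₀)

    I∖I₀⊆ : ∀ {x} → x ∈ I → x ∉ I₀ → x ≡ v ⊎ x ∈ C₀ ⊎ just x ∈ₗ []
    I∖I₀⊆ {x} _ x∉I₀ with x ≟ᶠ v
    ... | yes x≡v = inj₁ x≡v
    ... | no x≢v with x∈p∪q⁻ C₀ I₀ (inU x x≢v)
    ...   | inj₁ x∈C₀ = inj₂ (inj₁ x∈C₀)
    ...   | inj₂ x∈I₀ = ⊥-elim (x∉I₀ x∈I₀)

    open StraySlots {X = C} {Y = I₀} {Z = C₀} v [] (clique∩independent-atMostOne G C-clique I₀-indep) (λ ()) C∖C₀⊆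
      using () renaming (strays to Ks; strays⊆X to Ks⊆C; X∖Z⊆strays to C∖C₀⊆Ks)

    open StraySlots {X = I} {Y = C₀} {Z = I₀} v []
      (λ a∈I a∈C₀ b∈I b∈C₀ → clique∩independent-atMostOne G C₀-clique I-indep a∈C₀ a∈I b∈C₀ b∈I)
      (λ ()) I∖I₀⊆
      using () renaming (strays to Js; strays⊆X to Js⊆I; X∖Z⊆strays to I∖I₀⊆Js)

    code : Code
    code = Ks , Js

    code∈codes : code ∈ₗ codes
    code∈codes = ∈-cartesianProduct⁺ (∈-Slots Ks refl) (∈-Slots Js refl)

    nothingIn∅ : ∀ {x y : Fin n} {b} → y ∈ ∅ → adj G x y ≡ b
    nothingIn∅ y∈∅ = ⊥-elim (∉⊥ y∈∅)

    module PC = PartProperties G {Ss = []} {S = ∅} (λ ()) true C₀-clique C-clique Ks⊆C Js⊆I C∩I≡∅ (∩-zeroʳ C)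
                  (λ _ _ _ → nothingIn∅)
    module PI = PartProperties G {Ss = []} {S = ∅} (λ ()) false (independent⇒homogeneous G I₀-indep)
                  (independent⇒homogeneous G I-indep) Js⊆I Ks⊆C (∩≡∅-sym C∩I≡∅) (∩-zeroʳ I)
                  (λ _ _ _ → nothingIn∅)

    W⊆decode : C ∪ I ⊆ decode code
    W⊆decode x∈W with x∈p∪q⁻ C I x∈W
    ... | inj₁ x∈C = x∈p∪q⁺ (inj₁ (PC.X⊆part C∖C₀⊆Ks x∈C))
    ... | inj₂ x∈I = x∈p∪q⁺ (inj₂ (PI.X⊆part I∖I₀⊆Js x∈I))

    decode-split : Split G (decode code)
    decode-split = _ , _ , refl , parts-disjoint G [] C₀∩I₀≡∅ C∩I≡∅ Ks⊆C Js⊆I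
                 , PC.part-homogeneous , homogeneous⇒independent G PI.part-homogeneous

  catalogue : Catalogue Split G v (1 * suc n ^ 4)
  catalogue = record
    { codes = codes ; length-codes = length-codes ; decode = decode
    ; covers = λ { _ (C , I , refl , C∩I , C-clique , I-indep) _ →
        let open Cover C∩I C-clique I-indep in code , code∈codes , W⊆decode , decode-split } }

CKS-split : CKS Split
CKS-split = CKS-fromCatalogues Split 1 4 λ
  { G (C₀ , I₀ , refl , C₀∩I₀≡∅ , C₀-clique , I₀-indep) inU →
      SplitCatalogue.catalogue G C₀∩I₀≡∅ C₀-clique I₀-indep inU }

module PseudoSplitCatalogue (G : Graph n) {v : Fin n} {C₀ S₀ I₀ : Subset n}
  (C₀∩I₀≡∅ : C₀ ∩ I₀ ≡ ∅) (C₀-clique : IsClique G C₀) (I₀-indep : IsIndependent G I₀)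
  (s₀ : S₀ ≡ ∅ ⊎ InducesC5 G S₀) (inU : ∀ x → x ≢ v → x ∈ C₀ ∪ S₀ ∪ I₀) where

  Code : Set
  Code = List (Maybe (Fin n)) × List (Maybe (Fin n)) × List (Maybe (Fin n))

  codes : List Code
  codes = cartesianProduct (Slots 5) (cartesianProduct (Slots 7) (Slots 7))

  length-codes : length codes ≡ 1 * suc n ^ 19
  length-codes = trans (length-cartesianProduct-^ (Slots {n} 5) sides (suc n) 5 14 (length-Slots n 5) length-sides)
                       (sym (ℕ.*-identityˡ (suc n ^ 19)))
    where
    sides : List (List (Maybe (Fin n)) × List (Maybe (Fin n)))
    sides = cartesianProduct (Slots 7) (Slots 7)

    length-sides : length sides ≡ suc n ^ 14
    length-sides = length-cartesianProduct-^ (Slots {n} 7) (Slots {n} 7) (suc n) 7 7 (length-Slots n 7) (length-Slots n 7)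

  decode : Code → Subset n
  decode (Ss , Ks , Js) = part G Ss true C₀ Ks Js ∪ listed Ss ∪ part G Ss false I₀ Js Ks

  home : ∀ {x} → x ≢ v → x ∈ C₀ ⊎ x ∈ S₀ ⊎ x ∈ I₀
  home {x} x≢v with x∈p∪q⁻ C₀ _ (inU x x≢v)
  ... | inj₁ x∈C₀ = inj₁ x∈C₀
  ... | inj₂ x∈S₀∪I₀ = inj₂ (x∈p∪q⁻ S₀ I₀ x∈S₀∪I₀)

  module Cover {C S I} (C∩S≡∅ : C ∩ S ≡ ∅) (C∩I≡∅ : C ∩ I ≡ ∅) (S∩I≡∅ : S ∩ I ≡ ∅)
           (C-clique : IsClique G C) (I-indep : IsIndependent G I) (s : S ≡ ∅ ⊎ InducesC5 G S)
           (C-S : ∀ x y → x ∈ C → y ∈ S → adj G x y ≡ true)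
           (I-S : ∀ x y → x ∈ I → y ∈ S → adj G x y ≡ false) where

    Ss : List (Maybe (Fin n))
    Ss = cycleSlots G s S

    Ss⊆S : ∀ {y} → just y ∈ₗ Ss → y ∈ S
    Ss⊆S y∈ = proj₁ (cycleSlots⊆ G s S y∈)

    C∖C₀⊆ : ∀ {x} → x ∈ C → x ∉ C₀ → x ≡ v ⊎ x ∈ I₀ ⊎ just x ∈ₗ cycleSlots G s₀ C
    C∖C₀⊆ {x} x∈C x∉C₀ with x ≟ᶠ v
    ... | yes x≡v = inj₁ x≡v
    ... | no x≢v with home x≢v
    ...   | inj₁ x∈C₀ = ⊥-elim (x∉C₀ x∈C₀)
    ...   | inj₂ (inj₁ x∈S₀) = inj₂ (inj₂ (⊆cycleSlots G s₀ C x∈S₀ x∈C))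
    ...   | inj₂ (inj₂ x∈I₀) = inj₂ (inj₁ x∈I₀)

    I∖I₀⊆ : ∀ {x} → x ∈ I → x ∉ I₀ → x ≡ v ⊎ x ∈ C₀ ⊎ just x ∈ₗ cycleSlots G s₀ I
    I∖I₀⊆ {x} x∈I x∉I₀ with x ≟ᶠ v
    ... | yes x≡v = inj₁ x≡v
    ... | no x≢v with home x≢v
    ...   | inj₁ x∈C₀ = inj₂ (inj₁ x∈C₀)
    ...   | inj₂ (inj₁ x∈S₀) = inj₂ (inj₂ (⊆cycleSlots G s₀ I x∈S₀ x∈I))
    ...   | inj₂ (inj₂ x∈I₀) = ⊥-elim (x∉I₀ x∈I₀)

    open StraySlots {X = C} {Y = I₀} {Z = C₀} v (cycleSlots G s₀ C)
      (clique∩independent-atMostOne G C-clique I₀-indep) (λ y∈ → proj₂ (cycleSlots⊆ G s₀ C y∈)) C∖C₀⊆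
      using () renaming (strays to Ks; strays⊆X to Ks⊆C; X∖Z⊆strays to C∖C₀⊆Ks)

    open StraySlots {X = I} {Y = C₀} {Z = I₀} v (cycleSlots G s₀ I)
      (λ a∈I a∈C₀ b∈I b∈C₀ → clique∩independent-atMostOne G C₀-clique I-indep a∈C₀ a∈I b∈C₀ b∈I)
      (λ y∈ → proj₂ (cycleSlots⊆ G s₀ I y∈)) I∖I₀⊆
      using () renaming (strays to Js; strays⊆X to Js⊆I; X∖Z⊆strays to I∖I₀⊆Js)

    code : Code
    code = Ss , Ks , Js

    code∈codes : code ∈ₗ codes
    code∈codes = ∈-cartesianProduct⁺ (∈-Slots Ss (length-cycleSlots G s S))
      (∈-cartesianProduct⁺ (∈-Slots Ks (cong (2 +_) (length-cycleSlots G s₀ C)))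
                           (∈-Slots Js (cong (2 +_) (length-cycleSlots G s₀ I))))

    C' S' I' : Subset n
    C' = part G Ss true C₀ Ks Js
    S' = listed Ss
    I' = part G Ss false I₀ Js Ks

    module PC = PartProperties G Ss⊆S true C₀-clique C-clique Ks⊆C Js⊆I C∩I≡∅ C∩S≡∅ C-S
    module PI = PartProperties G Ss⊆S false (independent⇒homogeneous G I₀-indep) (independent⇒homogeneous G I-indep)
                  Js⊆I Ks⊆C (∩≡∅-sym C∩I≡∅) (∩≡∅-sym S∩I≡∅) I-S

    S'≡S : S' ≡ S
    S'≡S = ⊆-antisym (λ y∈ → Ss⊆S (∈-select⁻ (_∈ₛ? Ss) y∈))
                     (λ y∈S → ∈-select⁺ (_∈ₛ? Ss) (⊆cycleSlots G s S y∈S y∈S))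

    W⊆decode : C ∪ S ∪ I ⊆ decode code
    W⊆decode x∈W with x∈p∪q⁻ C _ x∈W
    ... | inj₁ x∈C = x∈p∪q⁺ (inj₁ (PC.X⊆part C∖C₀⊆Ks x∈C))
    ... | inj₂ x∈S∪I with x∈p∪q⁻ S I x∈S∪I
    ...   | inj₁ x∈S = x∈p∪q⁺ (inj₂ (x∈p∪q⁺ (inj₁ (subst (_ ∈_) (sym S'≡S) x∈S))))
    ...   | inj₂ x∈I = x∈p∪q⁺ (inj₂ (x∈p∪q⁺ (inj₂ (PI.X⊆part I∖I₀⊆Js x∈I))))

    decode-pseudoSplit : PseudoSplit G (decode code)
    decode-pseudoSplit =
      C' , S' , I' , refl
      , disjoint⇒∩≡∅ (λ x∈C' x∈S' → PC.part-∉Ss x∈C' (∈-select⁻ (_∈ₛ? Ss) x∈S'))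
      , parts-disjoint G Ss C₀∩I₀≡∅ C∩I≡∅ Ks⊆C Js⊆I
      , disjoint⇒∩≡∅ (λ x∈S' x∈I' → PI.part-∉Ss x∈I' (∈-select⁻ (_∈ₛ? Ss) x∈S'))
      , PC.part-homogeneous
      , homogeneous⇒independent G PI.part-homogeneous
      , subst (λ T → T ≡ ∅ ⊎ InducesC5 G T) (sym S'≡S) s
      , (λ x y x∈C' y∈S' → PC.part-Ss x y x∈C' (∈-select⁻ (_∈ₛ? Ss) y∈S'))
      , (λ x y x∈I' y∈S' → PI.part-Ss x y x∈I' (∈-select⁻ (_∈ₛ? Ss) y∈S'))

  catalogue : Catalogue PseudoSplit G v (1 * suc n ^ 19)
  catalogue = record
    { codes = codes ; length-codes = length-codes ; decode = decode
    ; covers = λ { _ (C , S , I , refl , C∩S , C∩I , S∩I , C-clique , I-indep , s , C-S , I-S) _ →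
        let open Cover C∩S C∩I S∩I C-clique I-indep s C-S I-S
        in code , code∈codes , W⊆decode , decode-pseudoSplit } }

CKS-pseudoSplit : CKS PseudoSplit
CKS-pseudoSplit = CKS-fromCatalogues PseudoSplit 1 19 λ
  { G (C₀ , S₀ , I₀ , refl , _ , C₀∩I₀≡∅ , _ , C₀-clique , I₀-indep , s₀ , _ , _) inU →
      PseudoSplitCatalogue.catalogue G C₀∩I₀≡∅ C₀-clique I₀-indep s₀ inU }

IsSimplePattern : ∀ {k} → (Fin k → Fin k → Bool) → Set
IsSimplePattern H = (∀ i j → H i j ≡ H j i) × (∀ i → H i i ≡ false)

isSimplePattern? : ∀ {k} (H : Fin k → Fin k → Bool) → Dec (IsSimplePattern H)
isSimplePattern? H = all? (λ i → all? λ j → H i j ≟ᵇ H j i) ×-dec all? (λ i → H i i ≟ᵇ false)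

module _ {k} {H : Fin k → Fin k → Bool} (simple : IsSimplePattern H) (G : Graph n) where

  embedding-fromUpper : (f : Fin k → Fin n) → (∀ {i j} → i < j → f i ≢ f j × adj G (f i) (f j) ≡ H i j) →
                        InducedEmbedding H G f
  embedding-fromUpper f upper = injective , adjacency
    where
    injective : ∀ {i j} → f i ≡ f j → i ≡ j
    injective {i} {j} fi≡fj with <-cmp i j
    ... | tri< i<j _ _ = ⊥-elim (proj₁ (upper i<j) fi≡fj)
    ... | tri≈ _ i≡j _ = i≡j
    ... | tri> _ _ j<i = ⊥-elim (proj₁ (upper j<i) (sym fi≡fj))

    adjacency : ∀ i j → adj G (f i) (f j) ≡ H i j
    adjacency i j with <-cmp i j
    ... | tri< i<j _ _ = proj₂ (upper i<j)
    ... | tri≈ _ refl _ = trans (Graph.irrefl G (f i)) (sym (proj₂ simple i))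
    ... | tri> _ _ j<i = trans (adj-sym G (proj₂ (upper j<i))) (proj₁ simple j i)

quad : Fin n → Fin n → Fin n → Fin n → Fin 4 → Fin n
quad a b c d 0F = a
quad a b c d 1F = b
quad a b c d 2F = c
quad a b c d 3F = d

module _ {H : Fin 4 → Fin 4 → Bool} (simple : IsSimplePattern H) (G : Graph n) {a b c d : Fin n} where

  quad-embedding : a ≢ b → a ≢ c → a ≢ d → b ≢ c → b ≢ d → c ≢ d →
    adj G a b ≡ H 0F 1F → adj G a c ≡ H 0F 2F → adj G a d ≡ H 0F 3F →
    adj G b c ≡ H 1F 2F → adj G b d ≡ H 1F 3F →
    adj G c d ≡ H 2F 3F →
    InducedEmbedding H G (quad a b c d)
  quad-embedding a≢b a≢c a≢d b≢c b≢d c≢d ab ac ad bc bd cd = embedding-fromUpper simple G (quad a b c d) upper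
    where
    upper : ∀ {i j} → i < j → quad a b c d i ≢ quad a b c d j × adj G (quad a b c d i) (quad a b c d j) ≡ H i j
    upper {0F} {1F} _ = a≢b , ab
    upper {0F} {2F} _ = a≢c , ac
    upper {0F} {3F} _ = a≢d , ad
    upper {1F} {2F} _ = b≢c , bc
    upper {1F} {3F} _ = b≢d , bd
    upper {2F} {3F} _ = c≢d , cd
    upper {0F} {0F} ()
    upper {suc _} {0F} ()
    upper {1F} {1F} (s≤s ())
    upper {suc (suc _)} {1F} (s≤s ())
    upper {suc (suc _)} {2F} (s≤s (s≤s ()))
    upper {3F} {3F} (s≤s (s≤s (s≤s ())))

quad-⊆ : ∀ {X : Subset n} {a b c d} → a ∈ X → b ∈ X → c ∈ X → d ∈ X → ∀ i → quad a b c d i ∈ X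
quad-⊆ a∈X b∈X c∈X d∈X 0F = a∈X
quad-⊆ a∈X b∈X c∈X d∈X 1F = b∈X
quad-⊆ a∈X b∈X c∈X d∈X 2F = c∈X
quad-⊆ a∈X b∈X c∈X d∈X 3F = d∈X

twoK2-simple : IsSimplePattern twoK2
twoK2-simple = from-yes (isSimplePattern? twoK2)

C4-simple : IsSimplePattern C4
C4-simple = from-yes (isSimplePattern? C4)

P4-simple : IsSimplePattern P4
P4-simple = from-yes (isSimplePattern? P4)

-- Threshold graphs

module Vicinal (G : Graph n) {U : Subset n} (thrU : Threshold G U) where

  _≼_ : Fin n → Fin n → Set
  x ≼ y = ∀ w → w ∈ U → adj G w x ≡ true → w ≡ y ⊎ adj G w y ≡ true

  _≼?_ : ∀ x y → Dec (x ≼ y)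
  x ≼? y = all? (λ w → w ∈? U →-dec adj G w x ≟ᵇ true →-dec (w ≟ᶠ y ⊎-dec adj G w y ≟ᵇ true))

  ≼-refl : ∀ x → x ≼ x
  ≼-refl x w _ wx = inj₂ wx

  ≼-trans : ∀ {x y z} → x ∈ U → z ∈ U → x ≼ y → y ≼ z → x ≼ z
  ≼-trans {x} {y} {z} x∈U z∈U x≼y y≼z w w∈U wx with x≼y w w∈U wx
  ... | inj₂ wy = y≼z w w∈U wy
  ... | inj₁ refl with y≼z x x∈U (adj-sym G wx)
  ...   | inj₁ refl = inj₂ wx
  ...   | inj₂ xz with x≼y z z∈U (adj-sym G xz)
  ...     | inj₁ refl = inj₁ refl
  ...     | inj₂ zy = inj₂ (adj-sym G zy)

  ¬≼⇒witness : ∀ {x y} → ¬ x ≼ y → ∃ λ w → w ∈ U × adj G w x ≡ true × w ≢ y × adj G w y ≡ false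
  ¬≼⇒witness {x} {y} ¬x≼y
    with w , ¬step ← ¬∀⟶∃¬ n _ (λ w → w ∈? U →-dec adj G w x ≟ᵇ true →-dec (w ≟ᶠ y ⊎-dec adj G w y ≟ᵇ true))
                               ¬x≼y =
    w , decidable-stable (w ∈? U) (λ w∉U → ¬step λ w∈U → ⊥-elim (w∉U w∈U))
      , decidable-stable (adj G w x ≟ᵇ true) (λ ¬wx → ¬step λ _ wx → ⊥-elim (¬wx wx))
      , (λ w≡y → ¬step λ _ _ → inj₁ w≡y)
      , ¬-not (λ wy → ¬step λ _ _ → inj₂ wy)

  ≼-total : ∀ {x y} → x ∈ U → y ∈ U → x ≼ y ⊎ y ≼ x
  ≼-total {x} {y} x∈U y∈U with x ≼? y | y ≼? x
  ... | yes x≼y | _ = inj₁ x≼y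
  ... | no _ | yes y≼x = inj₂ y≼x
  ... | no ¬x≼y | no ¬y≼x
    with w₁ , w₁∈U , w₁x , w₁≢y , w₁y ← ¬≼⇒witness ¬x≼y
       | w₂ , w₂∈U , w₂y , w₂≢x , w₂x ← ¬≼⇒witness ¬y≼x
    = forbidden (adj G x y ≟ᵇ true) (adj G w₁ w₂ ≟ᵇ true)
    where
    -- w₁ sees x but not y and w₂ sees y but not x: these four vertices induce 2K₂, P₄ or C₄.
    x≢y : x ≢ y
    x≢y refl = not-¬ w₁x w₁y
    w₁≢w₂ : w₁ ≢ w₂
    w₁≢w₂ refl = not-¬ w₁x w₂x
    x≢w₁ : x ≢ w₁
    x≢w₁ = ≢-sym (adj⇒≢ G w₁x)
    y≢w₂ : y ≢ w₂
    y≢w₂ = ≢-sym (adj⇒≢ G w₂y)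

    forbidden : Dec (adj G x y ≡ true) → Dec (adj G w₁ w₂ ≡ true) → x ≼ y ⊎ y ≼ x
    forbidden (no ¬xy) (no ¬w₁w₂) = ⊥-elim (proj₁ thrU (quad x w₁ y w₂ ,
      quad-embedding twoK2-simple G x≢w₁ x≢y (≢-sym w₂≢x) w₁≢y w₁≢w₂ y≢w₂
        (adj-sym G w₁x) (¬-not ¬xy) (adj-sym G w₂x) w₁y (¬-not ¬w₁w₂) (adj-sym G w₂y) ,
      quad-⊆ x∈U w₁∈U y∈U w₂∈U))
    forbidden (yes xy) (no ¬w₁w₂) = ⊥-elim (proj₂ (proj₂ thrU) (quad w₁ x y w₂ ,
      quad-embedding P4-simple G (≢-sym x≢w₁) w₁≢y w₁≢w₂ x≢y (≢-sym w₂≢x) y≢w₂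
        w₁x w₁y (¬-not ¬w₁w₂) xy (adj-sym G w₂x) (adj-sym G w₂y) ,
      quad-⊆ w₁∈U x∈U y∈U w₂∈U))
    forbidden (no ¬xy) (yes w₁w₂) = ⊥-elim (proj₂ (proj₂ thrU) (quad x w₁ w₂ y ,
      quad-embedding P4-simple G x≢w₁ (≢-sym w₂≢x) x≢y w₁≢w₂ w₁≢y (≢-sym y≢w₂)
        (adj-sym G w₁x) (adj-sym G w₂x) (¬-not ¬xy) w₁w₂ w₁y w₂y ,
      quad-⊆ x∈U w₁∈U w₂∈U y∈U))
    forbidden (yes xy) (yes w₁w₂) = ⊥-elim (proj₁ (proj₂ thrU) (quad x w₁ w₂ y ,
      quad-embedding C4-simple G x≢w₁ (≢-sym w₂≢x) x≢y w₁≢w₂ w₁≢y (≢-sym y≢w₂)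
        (adj-sym G w₁x) (adj-sym G w₂x) xy w₁w₂ w₁y w₂y ,
      quad-⊆ x∈U w₁∈U w₂∈U y∈U))

  _≽_ : Fin n → Fin n → Set
  x ≽ y = y ≼ x

-- Adding v to a subset of U: since G[U] is threshold, a forbidden 4-vertex subgraph must pass through v,
-- and the two conditions below exclude exactly those.
module ThroughV (G : Graph n) {U : Subset n} {v : Fin n} (thrU : Threshold G U) (inU : ∀ x → x ≢ v → x ∈ U) where

  NeighboursSeeEdges : Subset n → Set
  NeighboursSeeEdges X = ∀ {a b b'} → a ∈ X → b ∈ X → b' ∈ X → adj G v a ≡ true → adj G v b ≡ false →
    adj G v b' ≡ false → b ≢ v → b' ≢ v → adj G b b' ≡ true → adj G a b ≡ true

  NonNeighboursMissNonEdges : Subset n → Set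
  NonNeighboursMissNonEdges X = ∀ {a a' b} → a ∈ X → a' ∈ X → b ∈ X → adj G v a ≡ true → adj G v a' ≡ true →
    a ≢ a' → adj G a a' ≡ false → adj G v b ≡ false → b ≢ v → adj G b a' ≡ false

  embedding-hits-v : ∀ {k} {H : Fin k → Fin k → Bool} → ¬ ContainsInduced H G U →
                     ∀ {f} → InducedEmbedding H G f → ∃ λ i → f i ≡ v
  embedding-hits-v noH {f} emb with any? (λ i → f i ≟ᶠ v)
  ... | yes hit = hit
  ... | no miss = ⊥-elim (noH (f , emb , λ i → inU (f i) (λ fi≡v → miss (i , fi≡v))))

  module AtV {k} {H : Fin k → Fin k → Bool} {f} (emb : InducedEmbedding H G f) {i} (fi≡v : f i ≡ v) where

    ad : ∀ j j' → adj G (f j) (f j') ≡ H j j'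
    ad = proj₂ emb

    v~ : ∀ j → adj G v (f j) ≡ H i j
    v~ j = subst (λ z → adj G z (f j) ≡ H i j) fi≡v (ad i j)

    ≢v : ∀ {j} → j ≢ i → f j ≢ v
    ≢v j≢i fj≡v = j≢i (proj₁ emb (trans fj≡v (sym fi≡v)))

    ≢f : ∀ {j j'} → j ≢ j' → f j ≢ f j'
    ≢f j≢j' fj≡fj' = j≢j' (proj₁ emb fj≡fj')

  threshold-fromConditions : ∀ {X} → NeighboursSeeEdges X → NonNeighboursMissNonEdges X → Threshold G X
  threshold-fromConditions {X} see miss = no2K2 , noC4 , noP4
    where
    no2K2 : ¬ ContainsInduced twoK2 G X
    no2K2 (f , emb , f∈X) with embedding-hits-v (proj₁ thrU) emb
    ... | 0F , fi≡v =
      not-¬ (see (f∈X 1F) (f∈X 2F) (f∈X 3F) (v~ 1F) (v~ 2F) (v~ 3F) (≢v λ ()) (≢v λ ()) (ad 2F 3F)) (ad 1F 2F)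
      where open AtV emb fi≡v
    ... | 1F , fi≡v =
      not-¬ (see (f∈X 0F) (f∈X 2F) (f∈X 3F) (v~ 0F) (v~ 2F) (v~ 3F) (≢v λ ()) (≢v λ ()) (ad 2F 3F)) (ad 0F 2F)
      where open AtV emb fi≡v
    ... | 2F , fi≡v =
      not-¬ (see (f∈X 3F) (f∈X 0F) (f∈X 1F) (v~ 3F) (v~ 0F) (v~ 1F) (≢v λ ()) (≢v λ ()) (ad 0F 1F)) (ad 3F 0F)
      where open AtV emb fi≡v
    ... | 3F , fi≡v =
      not-¬ (see (f∈X 2F) (f∈X 0F) (f∈X 1F) (v~ 2F) (v~ 0F) (v~ 1F) (≢v λ ()) (≢v λ ()) (ad 0F 1F)) (ad 2F 0F)
      where open AtV emb fi≡v

    noC4 : ¬ ContainsInduced C4 G X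
    noC4 (f , emb , f∈X) with embedding-hits-v (proj₁ (proj₂ thrU)) emb
    ... | 0F , fi≡v =
      not-¬ (ad 2F 3F) (miss (f∈X 1F) (f∈X 3F) (f∈X 2F) (v~ 1F) (v~ 3F) (≢f λ ()) (ad 1F 3F) (v~ 2F) (≢v λ ()))
      where open AtV emb fi≡v
    ... | 1F , fi≡v =
      not-¬ (ad 3F 2F) (miss (f∈X 0F) (f∈X 2F) (f∈X 3F) (v~ 0F) (v~ 2F) (≢f λ ()) (ad 0F 2F) (v~ 3F) (≢v λ ()))
      where open AtV emb fi≡v
    ... | 2F , fi≡v =
      not-¬ (ad 0F 3F) (miss (f∈X 1F) (f∈X 3F) (f∈X 0F) (v~ 1F) (v~ 3F) (≢f λ ()) (ad 1F 3F) (v~ 0F) (≢v λ ()))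
      where open AtV emb fi≡v
    ... | 3F , fi≡v =
      not-¬ (ad 1F 0F) (miss (f∈X 2F) (f∈X 0F) (f∈X 1F) (v~ 2F) (v~ 0F) (≢f λ ()) (ad 2F 0F) (v~ 1F) (≢v λ ()))
      where open AtV emb fi≡v

    noP4 : ¬ ContainsInduced P4 G X
    noP4 (f , emb , f∈X) with embedding-hits-v (proj₂ (proj₂ thrU)) emb
    ... | 0F , fi≡v =
      not-¬ (see (f∈X 1F) (f∈X 3F) (f∈X 2F) (v~ 1F) (v~ 3F) (v~ 2F) (≢v λ ()) (≢v λ ()) (ad 3F 2F)) (ad 1F 3F)
      where open AtV emb fi≡v
    ... | 1F , fi≡v =
      not-¬ (ad 3F 2F) (miss (f∈X 0F) (f∈X 2F) (f∈X 3F) (v~ 0F) (v~ 2F) (≢f λ ()) (ad 0F 2F) (v~ 3F) (≢v λ ()))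
      where open AtV emb fi≡v
    ... | 2F , fi≡v =
      not-¬ (ad 0F 1F) (miss (f∈X 3F) (f∈X 1F) (f∈X 0F) (v~ 3F) (v~ 1F) (≢f λ ()) (ad 3F 1F) (v~ 0F) (≢v λ ()))
      where open AtV emb fi≡v
    ... | 3F , fi≡v =
      not-¬ (see (f∈X 2F) (f∈X 0F) (f∈X 1F) (v~ 2F) (v~ 0F) (v~ 1F) (≢v λ ()) (≢v λ ()) (ad 0F 1F)) (ad 2F 0F)
      where open AtV emb fi≡v

  conditions-fromThreshold : ∀ {W} → Threshold G W → v ∈ W → NeighboursSeeEdges W × NonNeighboursMissNonEdges W
  conditions-fromThreshold {W} (no2K2 , noC4 , noP4) v∈W = see , miss
    where
    see : NeighboursSeeEdges W
    see {a} {b} {b'} a∈W b∈W b'∈W va vb vb' b≢v b'≢v bb' with adj G a b ≟ᵇ true | adj G a b' ≟ᵇ true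
    ... | yes ab | _ = ab
    ... | no ¬ab | no ¬ab' = ⊥-elim (no2K2 (quad v a b b' ,
      quad-embedding twoK2-simple G (adj⇒≢ G va) (≢-sym b≢v) (≢-sym b'≢v) (separated⇒≢ G va vb)
        (separated⇒≢ G va vb') (adj⇒≢ G bb') va vb vb' (¬-not ¬ab) (¬-not ¬ab') bb' ,
      quad-⊆ v∈W a∈W b∈W b'∈W))
    ... | no ¬ab | yes ab' = ⊥-elim (noP4 (quad v a b' b ,
      quad-embedding P4-simple G (adj⇒≢ G va) (≢-sym b'≢v) (≢-sym b≢v) (separated⇒≢ G va vb')
        (separated⇒≢ G va vb) (≢-sym (adj⇒≢ G bb')) va vb' vb ab' (¬-not ¬ab) (adj-sym G bb') ,
      quad-⊆ v∈W a∈W b'∈W b∈W))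

    miss : NonNeighboursMissNonEdges W
    miss {a} {a'} {b} a∈W a'∈W b∈W va va' a≢a' aa' vb b≢v with adj G b a' ≟ᵇ true | adj G b a ≟ᵇ true
    ... | no ¬ba' | _ = ¬-not ¬ba'
    ... | yes ba' | yes ba = ⊥-elim (noC4 (quad v a b a' ,
      quad-embedding C4-simple G (adj⇒≢ G va) (≢-sym b≢v) (adj⇒≢ G va') (separated⇒≢ G va vb) a≢a'
        (≢-sym (separated⇒≢ G va' vb)) va vb va' (adj-sym G ba) aa' ba' ,
      quad-⊆ v∈W a∈W b∈W a'∈W))
    ... | yes ba' | no ¬ba = ⊥-elim (noP4 (quad a v a' b ,
      quad-embedding P4-simple G (≢-sym (adj⇒≢ G va)) a≢a' (separated⇒≢ G va vb) (adj⇒≢ G va') (≢-sym b≢v)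
        (separated⇒≢ G va' vb) (adj-sym G va) aa' (adj-sym G (¬-not ¬ba)) va' vb (adj-sym G ba') ,
      quad-⊆ a∈W v∈W a'∈W b∈W))

module ThresholdCatalogue (G : Graph n) {U : Subset n} {v : Fin n}
                          (thrU : Threshold G U) (inU : ∀ x → x ≢ v → x ∈ U) where
  open Vicinal G thrU
  open ThroughV G thrU inU

  -- A threshold set W ∋ v is recorded by whether W ∩ N(v) is a clique, the ≼-least vertex of W ∩ N(v)
  -- and the ≼-greatest vertex of W ∖ N[v].
  Code : Set
  Code = Bool × Maybe (Fin n) × Maybe (Fin n)

  NeighbourMember : Code → Fin n → Set
  NeighbourMember (true , nothing , _) x = ⊥
  NeighbourMember (true , just a , _) x = x ≡ a ⊎ (adj G x a ≡ true × a ≼ x)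
  NeighbourMember (false , _ , nothing) x = ⊤
  NeighbourMember (false , nothing , just _) x = ⊥
  NeighbourMember (false , just a , just b) x =
    x ≡ a ⊎ (a ≼ x × (adj G x a ≡ false → adj G x b ≡ false × adj G a b ≡ false))

  NonNeighbourMember : Code → Fin n → Set
  NonNeighbourMember (true , nothing , _) x = ⊤
  NonNeighbourMember (true , just _ , nothing) x = ⊥
  NonNeighbourMember (true , just a , just b) x =
    x ≡ b ⊎ (x ≼ b × (adj G x b ≡ true → adj G x a ≡ true × adj G b a ≡ true))
  NonNeighbourMember (false , _ , nothing) x = ⊥
  NonNeighbourMember (false , _ , just b) x = x ≡ b ⊎ (adj G x b ≡ false × x ≼ b)

  neighbourMember? : ∀ c x → Dec (NeighbourMember c x)
  neighbourMember? (true , nothing , _) x = no λ ()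
  neighbourMember? (true , just a , _) x = x ≟ᶠ a ⊎-dec (adj G x a ≟ᵇ true ×-dec a ≼? x)
  neighbourMember? (false , _ , nothing) x = yes tt
  neighbourMember? (false , nothing , just _) x = no λ ()
  neighbourMember? (false , just a , just b) x =
    x ≟ᶠ a ⊎-dec (a ≼? x ×-dec (adj G x a ≟ᵇ false →-dec (adj G x b ≟ᵇ false ×-dec adj G a b ≟ᵇ false)))

  nonNeighbourMember? : ∀ c x → Dec (NonNeighbourMember c x)
  nonNeighbourMember? (true , nothing , _) x = yes tt
  nonNeighbourMember? (true , just _ , nothing) x = no λ ()
  nonNeighbourMember? (true , just a , just b) x =
    x ≟ᶠ b ⊎-dec (x ≼? b ×-dec (adj G x b ≟ᵇ true →-dec (adj G x a ≟ᵇ true ×-dec adj G b a ≟ᵇ true)))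
  nonNeighbourMember? (false , _ , nothing) x = no λ ()
  nonNeighbourMember? (false , _ , just b) x = x ≟ᶠ b ⊎-dec (adj G x b ≟ᵇ false ×-dec x ≼? b)

  Member : Code → Fin n → Set
  Member c x = x ≡ v ⊎ (adj G v x ≡ true × NeighbourMember c x) ⊎ (x ≢ v × adj G v x ≡ false × NonNeighbourMember c x)

  member? : ∀ c x → Dec (Member c x)
  member? c x = x ≟ᶠ v ⊎-dec (adj G v x ≟ᵇ true ×-dec neighbourMember? c x)
                       ⊎-dec (¬? (x ≟ᶠ v) ×-dec adj G v x ≟ᵇ false ×-dec nonNeighbourMember? c x)

  decode : Code → Subset n
  decode c = select (member? c)

  neighbourMember : ∀ {c x} → x ∈ decode c → adj G v x ≡ true → NeighbourMember c x
  neighbourMember {c} x∈ vx with ∈-select⁻ (member? c) x∈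
  ... | inj₁ refl = ⊥-elim (adj⇒≢ G vx refl)
  ... | inj₂ (inj₁ (_ , member)) = member
  ... | inj₂ (inj₂ (_ , vx≡false , _)) = ⊥-elim (not-¬ vx vx≡false)

  nonNeighbourMember : ∀ {c x} → x ∈ decode c → x ≢ v → adj G v x ≡ false → NonNeighbourMember c x
  nonNeighbourMember {c} x∈ x≢v ¬vx with ∈-select⁻ (member? c) x∈
  ... | inj₁ x≡v = ⊥-elim (x≢v x≡v)
  ... | inj₂ (inj₁ (vx , _)) = ⊥-elim (not-¬ vx ¬vx)
  ... | inj₂ (inj₂ (_ , _ , member)) = member

  neighbour∈U : ∀ {x} → adj G v x ≡ true → x ∈ U
  neighbour∈U vx = inU _ (≢-sym (adj⇒≢ G vx))

  decode-see : ∀ c → NeighboursSeeEdges (decode c)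
  decode-see c {a} {b} {b'} a∈ b∈ b'∈ va vb vb' b≢v b'≢v bb' =
    see c (neighbourMember a∈ va) (nonNeighbourMember b∈ b≢v vb) (nonNeighbourMember b'∈ b'≢v vb')
    where
    b∈U : b ∈ U
    b∈U = inU b b≢v

    see : ∀ c → NeighbourMember c a → NonNeighbourMember c b → NonNeighbourMember c b' → adj G a b ≡ true
    see (true , nothing , _) () _ _
    see (true , just _ , nothing) _ () _
    see (true , just a₁ , just b₁) A B B' = a~b A
      where
      b~b₁ : NonNeighbourMember (true , just a₁ , just b₁) b' → b ≢ b₁ → adj G b b₁ ≡ true
      b~b₁ (inj₁ refl) _ = bb'
      b~b₁ (inj₂ (b'≼b₁ , _)) b≢b₁ with b'≼b₁ b b∈U bb'
      ... | inj₁ b≡b₁ = ⊥-elim (b≢b₁ b≡b₁)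
      ... | inj₂ bb₁ = bb₁

      b~a₁' : Dec (b ≡ b₁) → NonNeighbourMember (true , just a₁ , just b₁) b →
              NonNeighbourMember (true , just a₁ , just b₁) b' → adj G b a₁ ≡ true
      b~a₁' (yes refl) _ (inj₁ refl) = ⊥-elim (adj⇒≢ G bb' refl)
      b~a₁' (yes refl) _ (inj₂ (_ , b'~b₁⇒)) = proj₂ (b'~b₁⇒ (adj-sym G bb'))
      b~a₁' (no b≢b₁) (inj₁ b≡b₁) _ = ⊥-elim (b≢b₁ b≡b₁)
      b~a₁' (no b≢b₁) (inj₂ (_ , b~b₁⇒)) B' = proj₁ (b~b₁⇒ (b~b₁ B' b≢b₁))

      b~a₁ : adj G b a₁ ≡ true
      b~a₁ = b~a₁' (b ≟ᶠ b₁) B B'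

      a~b : NeighbourMember (true , just a₁ , just b₁) a → adj G a b ≡ true
      a~b (inj₁ refl) = adj-sym G b~a₁
      a~b (inj₂ (_ , a₁≼a)) with a₁≼a b b∈U b~a₁
      ... | inj₁ refl = ⊥-elim (not-¬ va vb)
      ... | inj₂ ba = adj-sym G ba
    see (false , _ , nothing) _ () _
    see (false , ma , just b₁) _ B B' = ⊥-elim (noEdge B B')
      where
      noEdge : NonNeighbourMember (false , ma , just b₁) b → NonNeighbourMember (false , ma , just b₁) b' → ⊥
      noEdge (inj₁ refl) (inj₁ refl) = adj⇒≢ G bb' refl
      noEdge (inj₁ refl) (inj₂ (b'≁b₁ , _)) = not-¬ (adj-sym G bb') b'≁b₁
      noEdge (inj₂ (b≁b₁ , _)) (inj₁ refl) = not-¬ bb' b≁b₁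
      noEdge (inj₂ (b≁b₁ , _)) (inj₂ (b'≁b₁ , b'≼b₁)) with b'≼b₁ b b∈U bb'
      ... | inj₁ refl = not-¬ (adj-sym G bb') b'≁b₁
      ... | inj₂ bb₁ = not-¬ bb₁ b≁b₁

  decode-miss : ∀ c → NonNeighboursMissNonEdges (decode c)
  decode-miss c {a} {a'} {b} a∈ a'∈ b∈ va va' a≢a' aa' vb b≢v =
    miss c (neighbourMember a∈ va) (neighbourMember a'∈ va') (nonNeighbourMember b∈ b≢v vb)
    where
    a∈U : a ∈ U
    a∈U = neighbour∈U va
    a'∈U : a' ∈ U
    a'∈U = neighbour∈U va'

    miss : ∀ c → NeighbourMember c a → NeighbourMember c a' → NonNeighbourMember c b → adj G b a' ≡ false
    miss (true , nothing , _) () _ _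
    miss (true , just a₁ , mb) A A' _ = ⊥-elim (noNonEdge A A')
      where
      noNonEdge : NeighbourMember (true , just a₁ , mb) a → NeighbourMember (true , just a₁ , mb) a' → ⊥
      noNonEdge (inj₁ refl) (inj₁ refl) = a≢a' refl
      noNonEdge (inj₁ refl) (inj₂ (a'a , _)) = not-¬ (adj-sym G a'a) aa'
      noNonEdge (inj₂ (aa₁ , _)) (inj₁ refl) = not-¬ aa₁ aa'
      noNonEdge (inj₂ (aa₁ , _)) (inj₂ (_ , a₁≼a')) with a₁≼a' a a∈U aa₁
      ... | inj₁ a≡a' = a≢a' a≡a'
      ... | inj₂ aa'≡true = not-¬ aa'≡true aa'
    miss (false , _ , nothing) _ _ ()
    miss (false , nothing , just _) () _ _
    miss (false , just a₁ , just b₁) A A' B = b≁a' B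
      where
      a'≁a₁ : NeighbourMember (false , just a₁ , just b₁) a → adj G a' a₁ ≢ true
      a'≁a₁ (inj₁ refl) a'a₁ = not-¬ (adj-sym G a'a₁) aa'
      a'≁a₁ (inj₂ (a₁≼a , _)) a'a₁ with a₁≼a a' a'∈U a'a₁
      ... | inj₁ a'≡a = a≢a' (sym a'≡a)
      ... | inj₂ a'a = not-¬ (adj-sym G a'a) aa'

      a'≁b₁' : Dec (a' ≡ a₁) → NeighbourMember (false , just a₁ , just b₁) a →
               NeighbourMember (false , just a₁ , just b₁) a' → adj G a' b₁ ≡ false
      a'≁b₁' (yes refl) (inj₁ a≡a') _ = ⊥-elim (a≢a' a≡a')
      a'≁b₁' (yes refl) (inj₂ (_ , a≁a₁⇒)) _ = proj₂ (a≁a₁⇒ aa')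
      a'≁b₁' (no a'≢a₁) _ (inj₁ a'≡a₁) = ⊥-elim (a'≢a₁ a'≡a₁)
      a'≁b₁' (no _) A (inj₂ (_ , a'≁a₁⇒)) = proj₁ (a'≁a₁⇒ (¬-not (a'≁a₁ A)))

      a'≁b₁ : adj G a' b₁ ≡ false
      a'≁b₁ = a'≁b₁' (a' ≟ᶠ a₁) A A'

      b≁a' : NonNeighbourMember (false , just a₁ , just b₁) b → adj G b a' ≡ false
      b≁a' B with adj G b a' ≟ᵇ true
      ... | no ¬ba' = ¬-not ¬ba'
      b≁a' (inj₁ refl) | yes ba' = ⊥-elim (not-¬ (adj-sym G ba') a'≁b₁)
      b≁a' (inj₂ (bb₁ , b≼b₁)) | yes ba' with b≼b₁ a' a'∈U (adj-sym G ba')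
      ... | inj₁ refl = ⊥-elim (not-¬ ba' bb₁)
      ... | inj₂ a'b₁ = ⊥-elim (not-¬ a'b₁ a'≁b₁)

  module Cover {W : Subset n} (thrW : Threshold G W) (v∈W : v ∈ W) where

    see : NeighboursSeeEdges W
    see = proj₁ (conditions-fromThreshold thrW v∈W)

    miss : NonNeighboursMissNonEdges W
    miss = proj₂ (conditions-fromThreshold thrW v∈W)

    NonAdjacentNeighbours : Set
    NonAdjacentNeighbours = ∃ λ a → ∃ λ a' →
      a ∈ W × a' ∈ W × adj G v a ≡ true × adj G v a' ≡ true × a ≢ a' × adj G a a' ≡ false

    nonAdjacentNeighbours? : Dec NonAdjacentNeighbours
    nonAdjacentNeighbours? = any? λ a → any? λ a' → a ∈? W ×-dec a' ∈? W ×-dec adj G v a ≟ᵇ true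
      ×-dec adj G v a' ≟ᵇ true ×-dec ¬? (a ≟ᶠ a') ×-dec adj G a a' ≟ᵇ false

    neighbour? : ∀ x → Dec (x ∈ W × adj G v x ≡ true)
    neighbour? x = x ∈? W ×-dec adj G v x ≟ᵇ true

    nonNeighbour? : ∀ x → Dec (x ∈ W × x ≢ v × adj G v x ≡ false)
    nonNeighbour? x = x ∈? W ×-dec ¬? (x ≟ᶠ v) ×-dec adj G v x ≟ᵇ false

    Neighbours NonNeighbours : Subset n
    Neighbours = select neighbour?
    NonNeighbours = select nonNeighbour?

    open Least {U = U} _≼_ ≼-refl ≼-trans ≼-total using (LeastOf; least; leastVertex)
    open Least {U = U} _≽_ ≼-refl (λ x∈U z∈U x≽y y≽z → ≼-trans z∈U x∈U y≽z x≽y)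
                                 (λ x∈U y∈U → swap (≼-total x∈U y∈U))
      using () renaming (LeastOf to GreatestOf; least to greatest; leastVertex to greatestVertex)

    isClique : Dec NonAdjacentNeighbours → Bool
    isClique (yes _) = false
    isClique (no _) = true

    codeOf : Dec NonAdjacentNeighbours → LeastOf Neighbours → GreatestOf NonNeighbours → Code
    codeOf nc ra rb = isClique nc , leastVertex ra , greatestVertex rb

    neighbours⊆ : ∀ nc ra rb {x} → x ∈ W → adj G v x ≡ true → NeighbourMember (codeOf nc ra rb) x
    neighbours⊆ _ (inj₂ empty) _ x∈W vx = ⊥-elim (empty (∈-select⁺ neighbour? (x∈W , vx)))
    neighbours⊆ (no noNonEdge) (inj₁ (a , a∈N , a≼)) _ {x} x∈W vx
      with a∈W , va ← ∈-select⁻ neighbour? a∈N | x ≟ᶠ a | adj G x a ≟ᵇ true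
    ... | yes x≡a | _ = inj₁ x≡a
    ... | no x≢a | yes xa = inj₂ (xa , a≼ (∈-select⁺ neighbour? (x∈W , vx)))
    ... | no x≢a | no ¬xa = ⊥-elim (noNonEdge (x , a , x∈W , a∈W , vx , va , x≢a , ¬-not ¬xa))
    neighbours⊆ (yes _) (inj₁ _) (inj₂ _) _ _ = tt
    neighbours⊆ (yes _) (inj₁ (a , a∈N , a≼)) (inj₁ (b , b∈N̄ , _)) {x} x∈W vx
      with a∈W , va ← ∈-select⁻ neighbour? a∈N | b∈W , b≢v , vb ← ∈-select⁻ nonNeighbour? b∈N̄
         | x ≟ᶠ a
    ... | yes x≡a = inj₁ x≡a
    ... | no x≢a = inj₂ (a≼ (∈-select⁺ neighbour? (x∈W , vx)) , λ xa≡false →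
          adj-sym G (miss a∈W x∈W b∈W va vx (≢-sym x≢a) (adj-sym G xa≡false) vb b≢v)
        , adj-sym G (miss x∈W a∈W b∈W vx va x≢a xa≡false vb b≢v))

    nonNeighbours⊆ : ∀ nc ra rb {x} → x ∈ W → x ≢ v → adj G v x ≡ false → NonNeighbourMember (codeOf nc ra rb) x
    nonNeighbours⊆ _ _ (inj₂ empty) x∈W x≢v vx = ⊥-elim (empty (∈-select⁺ nonNeighbour? (x∈W , x≢v , vx)))
    nonNeighbours⊆ (no _) (inj₂ _) (inj₁ _) _ _ _ = tt
    nonNeighbours⊆ (no _) (inj₁ (a , a∈N , _)) (inj₁ (b , b∈N̄ , ≼b)) {x} x∈W x≢v vx
      with a∈W , va ← ∈-select⁻ neighbour? a∈N | b∈W , b≢v , vb ← ∈-select⁻ nonNeighbour? b∈N̄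
         | x ≟ᶠ b
    ... | yes x≡b = inj₁ x≡b
    ... | no x≢b = inj₂ (≼b (∈-select⁺ nonNeighbour? (x∈W , x≢v , vx)) , λ xb →
          adj-sym G (see a∈W x∈W b∈W va vx vb x≢v b≢v xb)
        , adj-sym G (see a∈W b∈W x∈W va vb vx b≢v x≢v (adj-sym G xb)))
    nonNeighbours⊆ (yes (p , q , p∈W , q∈W , vp , vq , p≢q , pq)) _ (inj₁ (b , b∈N̄ , ≼b)) {x} x∈W x≢v vx
      with b∈W , b≢v , vb ← ∈-select⁻ nonNeighbour? b∈N̄ | x ≟ᶠ b | adj G x b ≟ᵇ true
    ... | yes x≡b | _ = inj₁ x≡b
    ... | no _ | no ¬xb = inj₂ (¬-not ¬xb , ≼b (∈-select⁺ nonNeighbour? (x∈W , x≢v , vx)))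
    ... | no _ | yes xb =
      ⊥-elim (not-¬ (adj-sym G (see q∈W x∈W b∈W vq vx vb x≢v b≢v xb)) (miss p∈W q∈W x∈W vp vq p≢q pq vx x≢v))

    code : Code
    code = codeOf nonAdjacentNeighbours? leastNeighbour greatestNonNeighbour
      where
      leastNeighbour : LeastOf Neighbours
      leastNeighbour = least Neighbours (λ y∈ → neighbour∈U (proj₂ (∈-select⁻ neighbour? y∈)))

      greatestNonNeighbour : GreatestOf NonNeighbours
      greatestNonNeighbour = greatest NonNeighbours (λ y∈ → inU _ (proj₁ (proj₂ (∈-select⁻ nonNeighbour? y∈))))

    W⊆decode : W ⊆ decode code
    W⊆decode {x} x∈W with x ≟ᶠ v | adj G v x ≟ᵇ true
    ... | yes x≡v | _ = ∈-select⁺ (member? code) (inj₁ x≡v)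
    ... | no x≢v | yes vx = ∈-select⁺ (member? code) (inj₂ (inj₁ (vx , neighbours⊆ _ _ _ x∈W vx)))
    ... | no x≢v | no ¬vx =
      ∈-select⁺ (member? code) (inj₂ (inj₂ (x≢v , ¬-not ¬vx , nonNeighbours⊆ _ _ _ x∈W x≢v (¬-not ¬vx))))

  codes : List Code
  codes = cartesianProduct (true ∷ false ∷ []) (cartesianProduct (allMaybeFin n) (allMaybeFin n))

  length-codes : length codes ≡ 2 * suc n ^ 2
  length-codes = begin
    length codes                                          ≡⟨ length-cartesianProductWith _,_ (true ∷ false ∷ []) pairs ⟩
    2 * length pairs                                      ≡⟨ cong (2 *_) (length-cartesianProductWith _,_ vs vs) ⟩
    2 * (length vs * length vs)                           ≡⟨ cong (λ k → 2 * (k * k)) (length-allMaybeFin n) ⟩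
    2 * (suc n * suc n)                                   ≡⟨ cong (λ k → 2 * (suc n * k)) (ℕ.*-identityʳ (suc n)) ⟨
    2 * suc n ^ 2                                         ∎
    where
    open ≡-Reasoning
    vs : List (Maybe (Fin n))
    vs = allMaybeFin n
    pairs : List (Maybe (Fin n) × Maybe (Fin n))
    pairs = cartesianProduct vs vs

  ∈-codes : ∀ c → c ∈ₗ codes
  ∈-codes (flag , ma , mb) =
    ∈-cartesianProduct⁺ (∈-bools flag) (∈-cartesianProduct⁺ (∈-allMaybeFin ma) (∈-allMaybeFin mb))
    where
    ∈-bools : ∀ b → b ∈ₗ true ∷ false ∷ []
    ∈-bools true = here refl
    ∈-bools false = there (here refl)

  catalogue : Catalogue Threshold G v (2 * suc n ^ 2)
  catalogue = record
    { codes = codes ; length-codes = length-codes ; decode = decode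
    ; covers = λ W thrW v∈W → let open Cover thrW v∈W in
        code , ∈-codes code , W⊆decode , threshold-fromConditions (decode-see code) (decode-miss code) }

CKS-threshold : CKS Threshold
CKS-threshold = CKS-fromCatalogues Threshold 2 2 (λ G thrU inU → ThresholdCatalogue.catalogue G thrU inU)

proposition5p5 : CKS Split × CKS PseudoSplit × CKS Threshold × ((d : ℕ) → CKS (MaxDegreeAtMost d))
proposition5p5 = CKS-split , CKS-pseudoSplit , CKS-threshold , CKS-maxDegree
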